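{- Let $n\in\mathbb{P}$, $E_n^-=\{\sigma\in S_n:\sigma(1)>\sigma(2)<\sigma(3)>\cdots\}$ and $E_n^+=\{\sigma\in S_n:\sigma(1)<\sigma(2)>\sigma(3)<\cdots\}$. Then $$\sum_{\sigma\in E_n^- }(-1)^{\ell(\sigma)}x^{L(\sigma)}=\begin{cases}0,& n\text{ odd},\\ (-x)^{n/2},& n \text{ even},\end{cases}\qquad \sum_{\sigma\in E_n^+}(-1)^{\ell(\sigma)}x^{L(\sigma)}=\begin{cases}0,& n\text{ odd},\\ x^{\frac n2(\frac n2-1)},& n \text{ even}.\end{cases}$$
   Context: $S_n$ is the symmetric group on $[n]$. For $\sigma\in S_n$: $\ell(\sigma)$ = number of pairs $i<j$ with $\sigma(i)>\sigma(j)$; $L(\sigma)$ = number of such pairs with $i\not\equiv j\pmod 2$. The defining inequalities of $E_n^\pm$ alternate along all $n$ positions. -}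

module Defs where

open import Level using (Level)
open import Data.Bool using (Bool; true; false; if_then_else_; _∧_; not)
open import Data.Nat using (ℕ; zero; suc; _+_; _<ᵇ_; _≡ᵇ_; _%_)
open import Data.Fin using (Fin; toℕ)
open import Data.Vec using (Vec; []; _∷_; lookup)
open import Data.List using (List; []; _∷_; [_]; map; concatMap; filterᵇ; foldr; allFin; length)
open import Data.Bool.ListAction using (and)
open import Data.Product using (_×_; _,_)
open import Algebra.Bundles using (CommutativeRing)
import Algebra.Definitions.RawSemiring as RS
open import Algebra.Bundles using (Semiring)

-- A map [n] → [n] is encoded (0-indexed) by the vector of its values
-- (σ(1),…,σ(n)) ↦ (lookup σ 0, …, lookup σ (n-1)).

allVecs : (n k : ℕ) → List (Vec (Fin n) k)
allVecs n zero = [ [] ]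
allVecs n (suc k) = concatMap (λ v → map (λ a → a ∷ v) (allFin n)) (allVecs n k)

pairs : (n : ℕ) → List (Fin n × Fin n)
pairs n = concatMap (λ i → map (λ j → (i , j)) (filterᵇ (λ j → toℕ i <ᵇ toℕ j) (allFin n))) (allFin n)

isPerm : {n : ℕ} → Vec (Fin n) n → Bool
isPerm {n} σ = and (map (λ { (i , j) → not (toℕ (lookup σ i) ≡ᵇ toℕ (lookup σ j)) }) (pairs n))

Sym : (n : ℕ) → List (Vec (Fin n) n)
Sym n = filterᵇ isPerm (allVecs n n)

isInv : {n : ℕ} → Vec (Fin n) n → Fin n × Fin n → Bool
isInv σ (i , j) = toℕ (lookup σ j) <ᵇ toℕ (lookup σ i)

oppParity : {n : ℕ} → Fin n × Fin n → Bool
oppParity (i , j) = (toℕ i + toℕ j) % 2 ≡ᵇ 1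

ℓ : {n : ℕ} → Vec (Fin n) n → ℕ
ℓ {n} σ = length (filterᵇ (isInv σ) (pairs n))

L : {n : ℕ} → Vec (Fin n) n → ℕ
L {n} σ = length (filterᵇ (λ p → isInv σ p ∧ oppParity p) (pairs n))

-- With 1-indexed positions k = toℕ i + 1:
--   E⁻ : σ(1) > σ(2) < σ(3) > ⋯  i.e. σ(k) > σ(k+1) for k odd, σ(k) < σ(k+1) for k even;
--   E⁺ : σ(1) < σ(2) > σ(3) < ⋯  i.e. σ(k) < σ(k+1) for k odd, σ(k) > σ(k+1) for k even.
-- (toℕ i even  ⇔  k odd)
isDownUp : {n : ℕ} → Vec (Fin n) n → Bool
isDownUp {n} σ = and (map step (pairs n))
  where
  step : Fin n × Fin n → Bool
  step (i , j) = if toℕ j ≡ᵇ suc (toℕ i)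
                 then (if toℕ i % 2 ≡ᵇ 0
                       then toℕ (lookup σ j) <ᵇ toℕ (lookup σ i)
                       else toℕ (lookup σ i) <ᵇ toℕ (lookup σ j))
                 else true

isUpDown : {n : ℕ} → Vec (Fin n) n → Bool
isUpDown {n} σ = and (map step (pairs n))
  where
  step : Fin n × Fin n → Bool
  step (i , j) = if toℕ j ≡ᵇ suc (toℕ i)
                 then (if toℕ i % 2 ≡ᵇ 0
                       then toℕ (lookup σ i) <ᵇ toℕ (lookup σ j)
                       else toℕ (lookup σ j) <ᵇ toℕ (lookup σ i))
                 else true

Eminus : (n : ℕ) → List (Vec (Fin n) n)
Eminus n = filterᵇ isDownUp (Sym n)

Eplus : (n : ℕ) → List (Vec (Fin n) n)
Eplus n = filterᵇ isUpDown (Sym n)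

module _ {c ℓ′ : Level} (R : CommutativeRing c ℓ′) where
  open CommutativeRing R using (Carrier; semiring; 0#; 1#; -_) renaming (_+_ to _+R_; _*_ to _*R_)
  open RS (Semiring.rawSemiring semiring) using (_^_)

  pow : Carrier → ℕ → Carrier
  pow = _^_

  signedSum : {n : ℕ} → List (Vec (Fin n) n) → Carrier → Carrier
  signedSum E x = foldr (λ σ acc → ((- 1#) ^ ℓ σ) *R (x ^ L σ) +R acc) 0# E

module Submission where

-- Fix a parity p. A value a with a+1 < n and parity p is a candidate; it is linked in σ when the
-- values a and a+1 sit at positions of opposite parity. The involution ι_p swaps the values a, a+1
-- of σ for the first unlinked candidate a (and fixes σ if there is none). An unlinked swap keeps σ
-- alternating (adjacent positions have opposite parity) and keeps L, but changes ℓ by exactly one,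
-- so in any commutative ring the signed sum reduces to the fixed points of ι_p: the σ in which
-- every candidate is linked.
--   With p = even, the only fixed point in E⁻_{2k} is the zigzag τ⁻ = 2 1 4 3 …, with ℓ = L = k,
-- and the only one in E⁺_{2k} is its value-reflection τ⁺, with ℓ even and L = k(k-1). For odd n
-- there is no fixed point (p = even on E⁺, p = odd on E⁻).

open import Defs
open import Level using (Level)
open import Algebra.Bundles using (CommutativeRing)
open import Data.Bool using (Bool; true; false; T; T?; not; _∧_; _∨_; _xor_; if_then_else_)
open import Data.Bool.ListAction using (and; or)
import Data.Bool.Properties as Boolₚ
open import Data.Empty using (⊥; ⊥-elim)
open import Data.Fin using (Fin; toℕ; fromℕ<; punchOut) renaming (zero to fzero; suc to fsuc)
import Data.Fin.Properties as Finₚ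
open import Data.List using (List; []; _∷_; [_]; map; concatMap; filter; filterᵇ; foldr; allFin; length; _++_; upTo)
import Data.List.Properties as Listₚ
open import Data.List.Membership.Propositional using (_∈_; find; lose)
open import Data.List.Membership.Propositional.Properties
  using (∈-concatMap⁺; ∈-concatMap⁻; ∈-map⁺; ∈-map⁻; ∈-filter⁺; ∈-filter⁻; ∈-allFin; ∈-upTo⁺; ∈-upTo⁻; ∈-++⁺ˡ; ∈-++⁺ʳ; ∈-++⁻)
open import Data.List.Membership.Propositional.Properties.WithK using (unique∧set⇒bag)
open import Data.List.Relation.Binary.BagAndSetEquality using (∼bag⇒↭)
open import Data.List.Relation.Binary.Permutation.Propositional using (_↭_)
open import Data.List.Relation.Binary.Permutation.Propositional.Properties using (↭-length; filter-↭)
open import Data.List.Relation.Unary.All as All using ([]; _∷_)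
open import Data.List.Relation.Unary.All.Properties using (all⁺; all⁻)
open import Data.List.Relation.Unary.AllPairs using ([]; _∷_)
open import Data.List.Relation.Unary.Any as Any using (here; there)
open import Data.List.Relation.Unary.Any.Properties using (any⁺; any⁻)
open import Data.List.Relation.Unary.Unique.Propositional using (Unique)
import Data.List.Relation.Unary.Unique.Propositional.Properties as Uniqueₚ
open import Data.Maybe using (Maybe; just; nothing)
open import Data.Nat using (ℕ; zero; suc; pred; _+_; _*_; _≤_; _<_; _∸_; _<ᵇ_; _≡ᵇ_; _%_; z≤n; s≤s)
import Data.Nat.DivMod as DivMod
open import Data.Nat.Induction using (<-rec)
import Data.Nat.Properties as ℕₚ
open import Data.Product using (_×_; _,_; proj₁; proj₂; ∃-syntax)
open import Data.Sum using (_⊎_; inj₁; inj₂)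
open import Data.Unit using (tt)
open import Data.Vec using (Vec; []; _∷_; lookup; tabulate; head; tail) renaming (map to vmap)
import Data.Vec.Properties as Vecₚ
open import Function using (_∘_; Equivalence; mk⇔)
open import Relation.Binary.Definitions using (DecidableEquality; tri<; tri≈; tri>)
open import Relation.Binary.PropositionalEquality hiding ([_])
open import Relation.Nullary using (¬_; Dec; yes; no; ¬?)
open import Relation.Unary using (Decidable)

-- Parity, as a structurally recursive test: easier to reason with than `n % 2`.
isEven : ℕ → Bool
isEven zero    = true
isEven (suc n) = not (isEven n)

%2-isEven : ∀ n → n % 2 ≡ (if isEven n then 0 else 1)
%2-isEven zero          = refl
%2-isEven (suc zero)    = refl
%2-isEven (suc (suc n)) = begin
  (2 + n) % 2                             ≡⟨ cong (_% 2) (ℕₚ.+-comm 2 n) ⟩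
  (n + 2) % 2                             ≡⟨ DivMod.[m+n]%n≡m%n n 2 ⟩
  n % 2                                   ≡⟨ %2-isEven n ⟩
  (if isEven n then 0 else 1)             ≡⟨ cong (λ b → if b then 0 else 1) (sym (Boolₚ.not-involutive (isEven n))) ⟩
  (if not (not (isEven n)) then 0 else 1) ∎
  where open ≡-Reasoning

even-test : ∀ n → (n % 2 ≡ᵇ 0) ≡ isEven n
even-test n rewrite %2-isEven n with isEven n
... | true  = refl
... | false = refl

odd-test : ∀ n → (n % 2 ≡ᵇ 1) ≡ not (isEven n)
odd-test n rewrite %2-isEven n with isEven n
... | true  = refl
... | false = refl

isEven-+ : ∀ a b → isEven (a + b) ≡ (if isEven a then isEven b else not (isEven b))
isEven-+ zero    b = refl
isEven-+ (suc a) b rewrite isEven-+ a b with isEven a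
... | true  = refl
... | false = Boolₚ.not-involutive (isEven b)

isEven-double : ∀ k → isEven (k + k) ≡ true
isEven-double k rewrite isEven-+ k k with isEven k
... | true  = refl
... | false = refl

isEven-+suc : ∀ a b → isEven (a + suc b) ≡ not (isEven (a + b))
isEven-+suc a b = cong isEven (ℕₚ.+-suc a b)

isEven-consecutive : ∀ a → isEven (a + suc a) ≡ false
isEven-consecutive a rewrite isEven-+suc a a = cong not (isEven-double a)

equal-parity⇒≢suc : ∀ {a b} → isEven a ≡ isEven b → b ≢ suc a
equal-parity⇒≢suc e refl = Boolₚ.not-¬ refl e

all-∈ : ∀ {A : Set} (g : A → Bool) xs → T (and (map g xs)) → ∀ {x} → x ∈ xs → T (g x)
all-∈ g xs t = All.lookup (all⁺ g xs t)

∈-all : ∀ {A : Set} (g : A → Bool) xs → (∀ {x} → x ∈ xs → T (g x)) → T (and (map g xs))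
∈-all g xs h = all⁻ g (All.tabulate h)

any-∈ : ∀ {A : Set} (g : A → Bool) xs → T (or (map g xs)) → ∃[ x ] (x ∈ xs × T (g x))
any-∈ g xs t = find (any⁻ g xs t)

∈-any : ∀ {A : Set} (g : A → Bool) {xs x} → x ∈ xs → T (g x) → T (or (map g xs))
∈-any g m t = any⁺ g (lose m t)

true≢false : true ≢ false
true≢false ()

T-ext : ∀ {b c : Bool} → (T b → T c) → (T c → T b) → b ≡ c
T-ext {true}  {true}  _ _ = refl
T-ext {true}  {false} f _ = ⊥-elim (f tt)
T-ext {false} {true}  _ g = ⊥-elim (g tt)
T-ext {false} {false} _ _ = refl

T⇒≡true : ∀ {b} → T b → b ≡ true
T⇒≡true = Equivalence.to Boolₚ.T-≡

≡true⇒T : ∀ {b} → b ≡ true → T b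
≡true⇒T = Equivalence.from Boolₚ.T-≡

¬T⇒≡false : ∀ {b} → ¬ T b → b ≡ false
¬T⇒≡false {false} _ = refl
¬T⇒≡false {true}  h = ⊥-elim (h tt)

<ᵇ-cong : ∀ {a b c d} → (a < b → c < d) → (c < d → a < b) → (a <ᵇ b) ≡ (c <ᵇ d)
<ᵇ-cong {a} {b} {c} {d} f g =
  T-ext (λ t → ℕₚ.<⇒<ᵇ (f (ℕₚ.<ᵇ⇒< a b t))) (λ t → ℕₚ.<⇒<ᵇ (g (ℕₚ.<ᵇ⇒< c d t)))

≡ᵇ-cong : ∀ {a b c d} → (a ≡ b → c ≡ d) → (c ≡ d → a ≡ b) → (a ≡ᵇ b) ≡ (c ≡ᵇ d)
≡ᵇ-cong {a} {b} {c} {d} f g =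
  T-ext (λ t → ℕₚ.≡⇒≡ᵇ c d (f (ℕₚ.≡ᵇ⇒≡ a b t))) (λ t → ℕₚ.≡⇒≡ᵇ a b (g (ℕₚ.≡ᵇ⇒≡ c d t)))

≡ᵇ-refl : ∀ n → (n ≡ᵇ n) ≡ true
≡ᵇ-refl n = T⇒≡true (ℕₚ.≡⇒≡ᵇ n n refl)

≢⇒≡ᵇ-false : ∀ {a b} → a ≢ b → (a ≡ᵇ b) ≡ false
≢⇒≡ᵇ-false {a} {b} h = ¬T⇒≡false (h ∘ ℕₚ.≡ᵇ⇒≡ a b)

≮⇒<ᵇ-false : ∀ {a b} → ¬ (a < b) → (a <ᵇ b) ≡ false
≮⇒<ᵇ-false {a} {b} h = ¬T⇒≡false (h ∘ ℕₚ.<ᵇ⇒< a b)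

<ᵇ-flip : ∀ {x y} → x ≢ y → (x <ᵇ y) ≡ not (y <ᵇ x)
<ᵇ-flip {x} {y} ne with ℕₚ.<-cmp x y
... | tri< p _ _ rewrite T⇒≡true (ℕₚ.<⇒<ᵇ p) | ≮⇒<ᵇ-false (ℕₚ.<⇒≯ p) = refl
... | tri≈ _ e _ = ⊥-elim (ne e)
... | tri> _ _ p rewrite T⇒≡true (ℕₚ.<⇒<ᵇ p) | ≮⇒<ᵇ-false (ℕₚ.<⇒≯ p) = refl

filterᵇ-cong : ∀ {A : Set} {g h : A → Bool} (xs : List A) → (∀ {x} → x ∈ xs → g x ≡ h x) → filterᵇ g xs ≡ filterᵇ h xs
filterᵇ-cong [] _ = refl
filterᵇ-cong {g = g} {h} (x ∷ xs) e with g x | h x | e (here refl)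
... | true  | true  | refl = cong (x ∷_) (filterᵇ-cong xs (e ∘ there))
... | false | false | refl = filterᵇ-cong xs (e ∘ there)

concatMap-unique : ∀ {A B : Set} (F : A → List B) (origin : B → A) {xs : List A} → Unique xs →
  (∀ x → Unique (F x)) → (∀ {x y} → y ∈ F x → origin y ≡ x) → Unique (concatMap F xs)
concatMap-unique F origin {[]} _ _ _ = []
concatMap-unique F origin {x ∷ xs} (x∉xs ∷ uxs) uF back =
  Uniqueₚ.++⁺ (uF x) (concatMap-unique F origin uxs uF back) disjoint
  where
  disjoint : ∀ {v} → ¬ (v ∈ F x × v ∈ concatMap F xs)
  disjoint (p , q) with find (∈-concatMap⁻ F {xs = xs} q)
  ... | x' , m , r = All.lookup x∉xs m (trans (sym (back p)) (back r))

∈pairs⁺ : ∀ {n} {i j : Fin n} → toℕ i < toℕ j → (i , j) ∈ pairs n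
∈pairs⁺ {n} {i} {j} lt = ∈-concatMap⁺ _ (Any.map (λ { refl → ∈-map⁺ _ j∈ }) (∈-allFin i))
  where j∈ = ∈-filter⁺ (λ j → T? (toℕ i <ᵇ toℕ j)) (∈-allFin j) (ℕₚ.<⇒<ᵇ lt)

∈pairs⁻ : ∀ {n} {i j : Fin n} → (i , j) ∈ pairs n → toℕ i < toℕ j
∈pairs⁻ {n} {i} {j} p with find (∈-concatMap⁻ _ {xs = allFin n} p)
... | _ , _ , q with ∈-map⁻ _ q
... | _ , r , refl = ℕₚ.<ᵇ⇒< _ _ (proj₂ (∈-filter⁻ _ {xs = allFin n} r))

pairs-unique : ∀ n → Unique (pairs n)
pairs-unique n = concatMap-unique _ proj₁ (Uniqueₚ.allFin⁺ n)
  (λ i → Uniqueₚ.map⁺ (cong proj₂) (Uniqueₚ.filter⁺ _ (Uniqueₚ.allFin⁺ n)))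
  (λ m → first m)
  where
  first : ∀ {i p} → p ∈ map (λ j → (i , j)) (filterᵇ (λ j → toℕ i <ᵇ toℕ j) (allFin n)) → proj₁ p ≡ i
  first m with ∈-map⁻ _ m
  ... | _ , _ , refl = refl

∈allVecs : ∀ n k (v : Vec (Fin n) k) → v ∈ allVecs n k
∈allVecs n zero    []      = here refl
∈allVecs n (suc k) (a ∷ w) = ∈-concatMap⁺ _ (Any.map (λ { refl → ∈-map⁺ _ (∈-allFin a) }) (∈allVecs n k w))

allVecs-unique : ∀ n k → Unique (allVecs n k)
allVecs-unique n zero    = [] ∷ []
allVecs-unique n (suc k) = concatMap-unique _ tail (allVecs-unique n k)
  (λ v → Uniqueₚ.map⁺ (cong head) (Uniqueₚ.allFin⁺ n))
  (λ m → tail-of m)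
  where
  tail-of : ∀ {v w} → w ∈ map (λ a → a ∷ v) (allFin n) → tail w ≡ v
  tail-of m with ∈-map⁻ _ m
  ... | _ , _ , refl = refl

-- The entries of a vector of Fin's, read as natural numbers at natural-number positions
-- (0 beyond the end); this is how the alternation and fixed-point arguments see σ.
entry : ∀ {n m} → Vec (Fin n) m → ℕ → ℕ
entry []       k       = 0
entry (x ∷ xs) zero    = toℕ x
entry (x ∷ xs) (suc k) = entry xs k

value : ∀ {n m} → Vec (Fin n) m → Fin m → ℕ
value σ i = toℕ (lookup σ i)

entry-value : ∀ {n m} (σ : Vec (Fin n) m) (i : Fin m) → entry σ (toℕ i) ≡ value σ i
entry-value (x ∷ xs) fzero    = refl
entry-value (x ∷ xs) (fsuc i) = entry-value xs i

entry-fromℕ< : ∀ {n m} (σ : Vec (Fin n) m) i (p : i < m) → entry σ i ≡ value σ (fromℕ< p)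
entry-fromℕ< σ i p = trans (cong (entry σ) (sym (Finₚ.toℕ-fromℕ< p))) (entry-value σ (fromℕ< p))

entry-bound : ∀ {n m} (σ : Vec (Fin n) m) k → k < m → entry σ k < n
entry-bound (x ∷ σ) zero    _        = Finₚ.toℕ<n x
entry-bound (x ∷ σ) (suc k) (s≤s lt) = entry-bound σ k lt

entry-ext : ∀ {n m} (σ τ : Vec (Fin n) m) → (∀ i → i < m → entry σ i ≡ entry τ i) → σ ≡ τ
entry-ext σ τ h = trans (sym (Vecₚ.tabulate∘lookup σ)) (trans (Vecₚ.tabulate-cong same) (Vecₚ.tabulate∘lookup τ))
  where
  same : ∀ i → lookup σ i ≡ lookup τ i
  same i = Finₚ.toℕ-injective (trans (sym (entry-value σ i)) (trans (h (toℕ i) (Finₚ.toℕ<n i)) (entry-value τ i)))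

fromEntries : ∀ n (g : ℕ → ℕ) → (∀ i → i < n → g i < n) → Vec (Fin n) n
fromEntries n g bounded = tabulate (λ i → fromℕ< (bounded (toℕ i) (Finₚ.toℕ<n i)))

entry-fromEntries : ∀ n g bounded → ∀ i → i < n → entry (fromEntries n g bounded) i ≡ g i
entry-fromEntries n g bounded i lt = begin
  entry (fromEntries n g bounded) i                      ≡⟨ entry-fromℕ< (fromEntries n g bounded) i lt ⟩
  toℕ (lookup (fromEntries n g bounded) (fromℕ< lt))     ≡⟨ cong toℕ (Vecₚ.lookup∘tabulate _ (fromℕ< lt)) ⟩
  toℕ (fromℕ< (bounded _ (Finₚ.toℕ<n (fromℕ< lt))))     ≡⟨ Finₚ.toℕ-fromℕ< _ ⟩
  g (toℕ (fromℕ< lt))                                    ≡⟨ cong g (Finₚ.toℕ-fromℕ< lt) ⟩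
  g i                                                    ∎
  where open ≡-Reasoning

perm-distinct : ∀ {n} (σ : Vec (Fin n) n) → T (isPerm σ) → ∀ {i j} → (i , j) ∈ pairs n → value σ i ≢ value σ j
perm-distinct {n} σ isσ m e = subst T (Equivalence.to Boolₚ.T-not-≡ (all-∈ _ (pairs n) isσ m)) (ℕₚ.≡⇒≡ᵇ _ _ e)

perm-injective : ∀ {n} (σ : Vec (Fin n) n) → T (isPerm σ) → ∀ {i j} → value σ i ≡ value σ j → i ≡ j
perm-injective σ isσ {i} {j} e with ℕₚ.<-cmp (toℕ i) (toℕ j)
... | tri< lt _ _ = ⊥-elim (perm-distinct σ isσ (∈pairs⁺ lt) e)
... | tri≈ _ eq _ = Finₚ.toℕ-injective eq
... | tri> _ _ gt = ⊥-elim (perm-distinct σ isσ (∈pairs⁺ gt) (sym e))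

perm-injectiveℕ : ∀ {n} (σ : Vec (Fin n) n) → T (isPerm σ) → ∀ {i j} → i < n → j < n → entry σ i ≡ entry σ j → i ≡ j
perm-injectiveℕ σ isσ {i} {j} p q e = begin
  i                  ≡⟨ Finₚ.toℕ-fromℕ< p ⟨
  toℕ (fromℕ< p)     ≡⟨ cong toℕ (perm-injective σ isσ (trans (sym (entry-fromℕ< σ i p)) (trans e (entry-fromℕ< σ j q)))) ⟩
  toℕ (fromℕ< q)     ≡⟨ Finₚ.toℕ-fromℕ< q ⟩
  j                  ∎
  where open ≡-Reasoning

perm-surjective : ∀ {n} (σ : Vec (Fin n) n) → T (isPerm σ) → (v : Fin n) → ∃[ i ] (lookup σ i ≡ v)
perm-surjective {suc n} σ isσ v with Finₚ.any? (λ i → lookup σ i Finₚ.≟ v)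
... | yes hit = hit
... | no miss with Finₚ.pigeonhole (ℕₚ.n<1+n n) (λ i → punchOut {i = v} {j = lookup σ i} (λ e → miss (i , sym e)))
... | i , j , i<j , e = ⊥-elim (Finₚ.<⇒≢ i<j (perm-injective σ isσ (cong toℕ
        (Finₚ.punchOut-injective {i = v} (λ e′ → miss (i , sym e′)) (λ e′ → miss (j , sym e′)) e))))

isPerm⁺ : ∀ {n} (σ : Vec (Fin n) n) → (∀ {i j} → i < j → j < n → entry σ i ≢ entry σ j) → T (isPerm σ)
isPerm⁺ {n} σ distinct = ∈-all _ (pairs n) λ { {i , j} m → Equivalence.from Boolₚ.T-not-≡ (¬T⇒≡false (λ t →
  distinct (∈pairs⁻ m) (Finₚ.toℕ<n j) (trans (entry-value σ i) (trans (ℕₚ.≡ᵇ⇒≡ _ _ t) (sym (entry-value σ j)))))) }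

swapℕ : ℕ → ℕ → ℕ
swapℕ zero    zero          = 1
swapℕ zero    (suc zero)    = 0
swapℕ zero    (suc (suc k)) = suc (suc k)
swapℕ (suc a) zero          = zero
swapℕ (suc a) (suc k)       = suc (swapℕ a k)

swapFin : ∀ {n} → ℕ → Fin n → Fin n
swapFin {suc (suc n)} zero    fzero           = fsuc fzero
swapFin {suc (suc n)} zero    (fsuc fzero)    = fzero
swapFin {suc (suc n)} zero    (fsuc (fsuc v)) = fsuc (fsuc v)
swapFin {suc zero}    zero    v               = v
swapFin               (suc a) fzero           = fzero
swapFin               (suc a) (fsuc v)        = fsuc (swapFin a v)

toℕ-swapFin : ∀ {n} a (v : Fin n) → suc a < n → toℕ (swapFin a v) ≡ swapℕ a (toℕ v)
toℕ-swapFin {suc (suc n)} zero    fzero           _        = refl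
toℕ-swapFin {suc (suc n)} zero    (fsuc fzero)    _        = refl
toℕ-swapFin {suc (suc n)} zero    (fsuc (fsuc v)) _        = refl
toℕ-swapFin {suc zero}    zero    v               (s≤s ())
toℕ-swapFin               (suc a) fzero           _        = refl
toℕ-swapFin               (suc a) (fsuc v)        (s≤s lt) = cong suc (toℕ-swapFin a v lt)

swapFin-involutive : ∀ {n} a (v : Fin n) → swapFin a (swapFin a v) ≡ v
swapFin-involutive {suc (suc n)} zero    fzero           = refl
swapFin-involutive {suc (suc n)} zero    (fsuc fzero)    = refl
swapFin-involutive {suc (suc n)} zero    (fsuc (fsuc v)) = refl
swapFin-involutive {suc zero}    zero    fzero           = refl
swapFin-involutive               (suc a) fzero           = refl
swapFin-involutive               (suc a) (fsuc v)        = cong fsuc (swapFin-involutive a v)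

swapℕ-involutive : ∀ a x → swapℕ a (swapℕ a x) ≡ x
swapℕ-involutive zero    zero          = refl
swapℕ-involutive zero    (suc zero)    = refl
swapℕ-involutive zero    (suc (suc k)) = refl
swapℕ-involutive (suc a) zero          = refl
swapℕ-involutive (suc a) (suc k)       = cong suc (swapℕ-involutive a k)

swapℕ-injective : ∀ a {x y} → swapℕ a x ≡ swapℕ a y → x ≡ y
swapℕ-injective a {x} {y} e = trans (sym (swapℕ-involutive a x)) (trans (cong (swapℕ a) e) (swapℕ-involutive a y))

swapℕ-≡ᵇ : ∀ a x c → (swapℕ a x ≡ᵇ swapℕ a c) ≡ (x ≡ᵇ c)
swapℕ-≡ᵇ a x c = ≡ᵇ-cong (swapℕ-injective a) (cong (swapℕ a))

swapℕ-≡ᵇ-image : ∀ a x {c d} → swapℕ a c ≡ d → (swapℕ a x ≡ᵇ d) ≡ (x ≡ᵇ c)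
swapℕ-≡ᵇ-image a x refl = swapℕ-≡ᵇ a x _

data SwapView (a : ℕ) : ℕ → ℕ → Set where
  lower : SwapView a a (suc a)
  upper : SwapView a (suc a) a
  other : ∀ {k} → k ≢ a → k ≢ suc a → SwapView a k k

swapView : ∀ a k → SwapView a k (swapℕ a k)
swapView zero    zero          = lower
swapView zero    (suc zero)    = upper
swapView zero    (suc (suc k)) = other (λ ()) (λ ())
swapView (suc a) zero          = other (λ ()) (λ ())
swapView (suc a) (suc k)       = shift (swapView a k)
  where
  shift : ∀ {a k s} → SwapView a k s → SwapView (suc a) (suc k) (suc s)
  shift lower         = lower
  shift upper         = upper
  shift (other p q)   = other (p ∘ ℕₚ.suc-injective) (q ∘ ℕₚ.suc-injective)

swapℕ-lower : ∀ a → swapℕ a a ≡ suc a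
swapℕ-lower zero    = refl
swapℕ-lower (suc a) = cong suc (swapℕ-lower a)

swapℕ-upper : ∀ a → swapℕ a (suc a) ≡ a
swapℕ-upper zero    = refl
swapℕ-upper (suc a) = cong suc (swapℕ-upper a)

FormsPair : ℕ → ℕ → ℕ → Set
FormsPair a x y = (x ≡ a × y ≡ suc a) ⊎ (x ≡ suc a × y ≡ a)

FormsPair-sym : ∀ {a x y} → FormsPair a x y → FormsPair a y x
FormsPair-sym (inj₁ (p , q)) = inj₂ (q , p)
FormsPair-sym (inj₂ (p , q)) = inj₁ (q , p)

swapℕ-preserves-< : ∀ a x y → x ≢ y → ¬ FormsPair a x y → (swapℕ a y <ᵇ swapℕ a x) ≡ (y <ᵇ x)
swapℕ-preserves-< a x y ne np with swapℕ a x | swapView a x | swapℕ a y | swapView a y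
... | _ | lower     | _ | lower     = ⊥-elim (ne refl)
... | _ | lower     | _ | upper     = ⊥-elim (np (inj₁ (refl , refl)))
... | _ | lower     | _ | other y≢a _ = <ᵇ-cong (λ p → ℕₚ.≤∧≢⇒< (ℕₚ.≤-pred p) y≢a) ℕₚ.m<n⇒m<1+n
... | _ | upper     | _ | lower     = ⊥-elim (np (inj₂ (refl , refl)))
... | _ | upper     | _ | upper     = ⊥-elim (ne refl)
... | _ | upper     | _ | other y≢a _ = <ᵇ-cong ℕₚ.m<n⇒m<1+n (λ p → ℕₚ.≤∧≢⇒< (ℕₚ.≤-pred p) y≢a)
... | _ | other _ x≢a′ | _ | lower = <ᵇ-cong (ℕₚ.<-trans (ℕₚ.n<1+n _)) (λ p → ℕₚ.≤∧≢⇒< p (x≢a′ ∘ sym))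
... | _ | other _ x≢a′ | _ | upper = <ᵇ-cong (λ p → ℕₚ.≤∧≢⇒< p (x≢a′ ∘ sym)) (ℕₚ.<-trans (ℕₚ.n<1+n _))
... | _ | other _ _  | _ | other _ _ = refl

swapℕ-reverses-< : ∀ a x y → FormsPair a x y → (swapℕ a y <ᵇ swapℕ a x) ≡ not (y <ᵇ x)
swapℕ-reverses-< a x y (inj₁ (refl , refl)) rewrite swapℕ-lower x | swapℕ-upper x = <ᵇ-flip (ℕₚ.<⇒≢ (ℕₚ.n<1+n x))
swapℕ-reverses-< a x y (inj₂ (refl , refl)) rewrite swapℕ-lower y | swapℕ-upper y = <ᵇ-flip (ℕₚ.<⇒≢ (ℕₚ.n<1+n y) ∘ sym)

swapℕ-fixes : ∀ {a k} → k ≢ a → k ≢ suc a → swapℕ a k ≡ k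
swapℕ-fixes {a} {k} p q with swapℕ a k | swapView a k
... | _ | lower     = ⊥-elim (p refl)
... | _ | upper     = ⊥-elim (q refl)
... | _ | other _ _ = refl

swapValues : ∀ {n} → ℕ → Vec (Fin n) n → Vec (Fin n) n
swapValues a σ = vmap (swapFin a) σ

value-swapValues : ∀ {n} a (σ : Vec (Fin n) n) i → suc a < n → value (swapValues a σ) i ≡ swapℕ a (value σ i)
value-swapValues a σ i lt = trans (cong toℕ (Vecₚ.lookup-map i (swapFin a) σ)) (toℕ-swapFin a (lookup σ i) lt)

swapValues-involutive : ∀ {n} a (σ : Vec (Fin n) n) → swapValues a (swapValues a σ) ≡ σ
swapValues-involutive a σ = trans (sym (Vecₚ.map-∘ (swapFin a) (swapFin a) σ))
  (trans (Vecₚ.map-cong (swapFin-involutive a) σ) (Vecₚ.map-id σ))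

-- The values a and a+1 of σ sit at positions of opposite parity: "a is linked in σ".
-- These are exactly the values that can be exchanged without changing L.
carriesPair : ℕ → ℕ → ℕ → Bool
carriesPair a x y = ((x ≡ᵇ a) ∧ (y ≡ᵇ suc a)) ∨ ((x ≡ᵇ suc a) ∧ (y ≡ᵇ a))

linkedAt : ∀ {n} → ℕ → Vec (Fin n) n → Fin n × Fin n → Bool
linkedAt a σ (i , j) = carriesPair a (value σ i) (value σ j) ∧ oppParity (i , j)

linked : ∀ {n} → ℕ → Vec (Fin n) n → Bool
linked {n} a σ = or (map (linkedAt a σ) (pairs n))

carriesPair⇒FormsPair : ∀ a x y → T (carriesPair a x y) → FormsPair a x y
carriesPair⇒FormsPair a x y t with Equivalence.to Boolₚ.T-∨ t
... | inj₁ u = let p , q = Equivalence.to Boolₚ.T-∧ u in inj₁ (ℕₚ.≡ᵇ⇒≡ _ _ p , ℕₚ.≡ᵇ⇒≡ _ _ q)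
... | inj₂ u = let p , q = Equivalence.to Boolₚ.T-∧ u in inj₂ (ℕₚ.≡ᵇ⇒≡ _ _ p , ℕₚ.≡ᵇ⇒≡ _ _ q)

FormsPair⇒carriesPair : ∀ a x y → FormsPair a x y → T (carriesPair a x y)
FormsPair⇒carriesPair a x y (inj₁ (refl , refl)) =
  Equivalence.from Boolₚ.T-∨ (inj₁ (Equivalence.from Boolₚ.T-∧ (ℕₚ.≡⇒≡ᵇ x x refl , ℕₚ.≡⇒≡ᵇ y y refl)))
FormsPair⇒carriesPair a x y (inj₂ (refl , refl)) =
  Equivalence.from (Boolₚ.T-∨ {(x ≡ᵇ y) ∧ (y ≡ᵇ x)})
    (inj₂ (Equivalence.from Boolₚ.T-∧ (ℕₚ.≡⇒≡ᵇ x x refl , ℕₚ.≡⇒≡ᵇ y y refl)))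

carriesPair-swap-self : ∀ a x y → carriesPair a (swapℕ a x) (swapℕ a y) ≡ carriesPair a x y
carriesPair-swap-self a x y = begin
  carriesPair a (swapℕ a x) (swapℕ a y)
    ≡⟨ cong₂ _∨_ (cong₂ _∧_ (image x (swapℕ-upper a)) (image y (swapℕ-lower a)))
                 (cong₂ _∧_ (image x (swapℕ-lower a)) (image y (swapℕ-upper a))) ⟩
  ((x ≡ᵇ suc a) ∧ (y ≡ᵇ a)) ∨ ((x ≡ᵇ a) ∧ (y ≡ᵇ suc a))
    ≡⟨ Boolₚ.∨-comm ((x ≡ᵇ suc a) ∧ (y ≡ᵇ a)) _ ⟩
  carriesPair a x y ∎
  where
  open ≡-Reasoning
  image = swapℕ-≡ᵇ-image a

carriesPair-swap-other : ∀ a b x y → swapℕ a b ≡ b → swapℕ a (suc b) ≡ suc b →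
  carriesPair b (swapℕ a x) (swapℕ a y) ≡ carriesPair b x y
carriesPair-swap-other a b x y fixb fixb′ =
  cong₂ _∨_ (cong₂ _∧_ (image x fixb) (image y fixb′)) (cong₂ _∧_ (image x fixb′) (image y fixb))
  where image = swapℕ-≡ᵇ-image a

hasParity : Bool → ℕ → Bool
hasParity p a = if p then isEven a else not (isEven a)

hasParity-same : ∀ {p a b} → T (hasParity p a) → T (hasParity p b) → isEven a ≡ isEven b
hasParity-same {true}  {a} {b} x y = trans (T⇒≡true x) (sym (T⇒≡true y))
hasParity-same {false} {a} {b} x y =
  trans (Equivalence.to Boolₚ.T-not-≡ x) (sym (Equivalence.to Boolₚ.T-not-≡ y))

candidates : Bool → ℕ → List ℕ
candidates p n = filterᵇ (λ a → hasParity p a ∧ (suc a <ᵇ n)) (upTo n)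

∈candidates⁻ : ∀ {p n a} → a ∈ candidates p n → T (hasParity p a) × suc a < n
∈candidates⁻ {p} {n} {a} m with Equivalence.to Boolₚ.T-∧ (proj₂ (∈-filter⁻ (λ a → T? (hasParity p a ∧ (suc a <ᵇ n))) {xs = upTo n} m))
... | par , lt = par , ℕₚ.<ᵇ⇒< _ _ lt

∈candidates⁺ : ∀ {p n a} → T (hasParity p a) → suc a < n → a ∈ candidates p n
∈candidates⁺ {p} {n} {a} par lt = ∈-filter⁺ (λ a → T? (hasParity p a ∧ (suc a <ᵇ n)))
  (∈-upTo⁺ (ℕₚ.<-trans (ℕₚ.n<1+n a) lt)) (Equivalence.from Boolₚ.T-∧ (par , ℕₚ.<⇒<ᵇ lt))

-- Swapping at one candidate does not change which candidates are linked:
-- two candidates either coincide or are at distance ≥ 2.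
linked-swapValues : ∀ {p n a b} (σ : Vec (Fin n) n) → a ∈ candidates p n → b ∈ candidates p n →
  linked b (swapValues a σ) ≡ linked b σ
linked-swapValues {p} {n} {a} {b} σ ma mb = cong or (Listₚ.map-cong same (pairs n))
  where
  a<n : suc a < n
  a<n = proj₂ (∈candidates⁻ {p} {n} {a} ma)
  parity : isEven a ≡ isEven b
  parity = hasParity-same {p} {a} {b} (proj₁ (∈candidates⁻ {p} {n} {a} ma)) (proj₁ (∈candidates⁻ {p} {n} {b} mb))
  carries : ∀ x y → carriesPair b (swapℕ a x) (swapℕ a y) ≡ carriesPair b x y
  carries x y with a ℕₚ.≟ b
  ... | yes refl = carriesPair-swap-self a x y
  ... | no a≢b   = carriesPair-swap-other a b x y
    (swapℕ-fixes (a≢b ∘ sym) (equal-parity⇒≢suc parity))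
    (swapℕ-fixes (equal-parity⇒≢suc (sym parity) ∘ sym) (a≢b ∘ sym ∘ ℕₚ.suc-injective))
  same : ∀ ij → linkedAt b (swapValues a σ) ij ≡ linkedAt b σ ij
  same (i , j) = cong (_∧ oppParity (i , j))
    (trans (cong₂ (carriesPair b) (value-swapValues a σ i a<n) (value-swapValues a σ j a<n)) (carries _ _))

firstUnlinked : ∀ {n} → Vec (Fin n) n → List ℕ → Maybe ℕ
firstUnlinked σ []       = nothing
firstUnlinked σ (a ∷ as) = if linked a σ then firstUnlinked σ as else just a

firstUnlinked-cong : ∀ {n} (σ τ : Vec (Fin n) n) as → (∀ {a} → a ∈ as → linked a σ ≡ linked a τ) →
  firstUnlinked σ as ≡ firstUnlinked τ as
firstUnlinked-cong σ τ []       _ = refl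
firstUnlinked-cong σ τ (a ∷ as) e rewrite e (here refl) with linked a τ
... | true  = firstUnlinked-cong σ τ as (e ∘ there)
... | false = refl

firstUnlinked-just : ∀ {n} (σ : Vec (Fin n) n) as {a} → firstUnlinked σ as ≡ just a → a ∈ as × linked a σ ≡ false
firstUnlinked-just σ (b ∷ as) e with linked b σ in eq
... | true = let m , u = firstUnlinked-just σ as e in there m , u
firstUnlinked-just σ (b ∷ as) refl | false = here refl , eq

firstUnlinked-nothing⁻ : ∀ {n} (σ : Vec (Fin n) n) as → firstUnlinked σ as ≡ nothing → ∀ {a} → a ∈ as → T (linked a σ)
firstUnlinked-nothing⁻ σ (b ∷ as) e m with linked b σ in eq
firstUnlinked-nothing⁻ σ (b ∷ as) e (here refl) | true = ≡true⇒T eq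
firstUnlinked-nothing⁻ σ (b ∷ as) e (there m)   | true = firstUnlinked-nothing⁻ σ as e m

firstUnlinked-nothing⁺ : ∀ {n} (σ : Vec (Fin n) n) as → (∀ {a} → a ∈ as → T (linked a σ)) → firstUnlinked σ as ≡ nothing
firstUnlinked-nothing⁺ σ []       _ = refl
firstUnlinked-nothing⁺ σ (b ∷ as) h rewrite T⇒≡true (h (here refl)) = firstUnlinked-nothing⁺ σ as (h ∘ there)

applySwap : ∀ {n} → Maybe ℕ → Vec (Fin n) n → Vec (Fin n) n
applySwap nothing  σ = σ
applySwap (just a) σ = swapValues a σ

ι : Bool → ∀ {n} → Vec (Fin n) n → Vec (Fin n) n
ι p {n} σ = applySwap (firstUnlinked σ (candidates p n)) σ

ι-involutive : ∀ p {n} (σ : Vec (Fin n) n) → ι p (ι p σ) ≡ σ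
ι-involutive p {n} σ with firstUnlinked σ (candidates p n) in eq
... | nothing rewrite eq = refl
... | just a rewrite trans (firstUnlinked-cong (swapValues a σ) σ (candidates p n)
                              (linked-swapValues σ (proj₁ (firstUnlinked-just σ _ eq)))) eq
  = swapValues-involutive a σ

Alt : Bool → ℕ → ℕ → Set
Alt true  x y = y < x
Alt false x y = x < y

altᵇ : Bool → ℕ → ℕ → Bool
altᵇ true  x y = y <ᵇ x
altᵇ false x y = x <ᵇ y

altᵇ⇒Alt : ∀ d {x y} → T (altᵇ d x y) → Alt d x y
altᵇ⇒Alt true  {x} {y} = ℕₚ.<ᵇ⇒< y x
altᵇ⇒Alt false {x} {y} = ℕₚ.<ᵇ⇒< x y

Alt⇒altᵇ : ∀ d {x y} → Alt d x y → T (altᵇ d x y)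
Alt⇒altᵇ true  = ℕₚ.<⇒<ᵇ
Alt⇒altᵇ false = ℕₚ.<⇒<ᵇ

-- Both alternation conditions of Defs are instances of one test: at each adjacent pair of
-- positions (i, i+1), σ must descend exactly when i has parity d (d = true for E⁻, false for E⁺).
alternationTest : ∀ {n} → Bool → Vec (Fin n) n → Fin n × Fin n → Bool
alternationTest d σ (i , j) =
  if toℕ j ≡ᵇ suc (toℕ i)
  then (if toℕ i % 2 ≡ᵇ 0 then altᵇ d (value σ i) (value σ j) else altᵇ (not d) (value σ i) (value σ j))
  else true

alternating : ∀ {n} → Bool → Vec (Fin n) n → Bool
alternating {n} d σ = and (map (alternationTest d σ) (pairs n))

adjacent-test : ∀ d u x y → (if u % 2 ≡ᵇ 0 then altᵇ d x y else altᵇ (not d) x y) ≡ altᵇ (hasParity d u) x y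
adjacent-test d u x y rewrite even-test u with isEven u | d
... | true  | true  = refl
... | true  | false = refl
... | false | true  = refl
... | false | false = refl

alternationTest-adjacent : ∀ {n} d (σ : Vec (Fin n) n) {i j} → toℕ j ≡ suc (toℕ i) →
  alternationTest d σ (i , j) ≡ altᵇ (hasParity d (toℕ i)) (value σ i) (value σ j)
alternationTest-adjacent d σ {i} {j} adj
  rewrite adj | ≡ᵇ-refl (toℕ i) = adjacent-test d (toℕ i) (value σ i) (value σ j)

Alternating : ∀ {n} → Bool → Vec (Fin n) n → Set
Alternating {n} d σ = ∀ k → suc k < n → Alt (hasParity d k) (entry σ k) (entry σ (suc k))

alternating⇒Alternating : ∀ {n} d (σ : Vec (Fin n) n) → T (alternating d σ) → Alternating d σ
alternating⇒Alternating {n} d σ t k sk<n =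
  transport (Finₚ.toℕ-fromℕ< k<n) (entry-fromℕ< σ k k<n) (entry-fromℕ< σ (suc k) sk<n)
    (altᵇ⇒Alt _ (subst T (alternationTest-adjacent d σ adj) (all-∈ _ (pairs n) t (∈pairs⁺ (subst (toℕ (fromℕ< k<n) <_) (sym adj) (ℕₚ.n<1+n _))))))
  where
  k<n = ℕₚ.<-trans (ℕₚ.n<1+n k) sk<n
  adj : toℕ (fromℕ< sk<n) ≡ suc (toℕ (fromℕ< k<n))
  adj = trans (Finₚ.toℕ-fromℕ< sk<n) (cong suc (sym (Finₚ.toℕ-fromℕ< k<n)))
  transport : ∀ {u u′ x x′ y y′} → u ≡ u′ → x′ ≡ x → y′ ≡ y → Alt (hasParity d u) x y → Alt (hasParity d u′) x′ y′
  transport refl refl refl a = a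

Alternating⇒alternating : ∀ {n} d (σ : Vec (Fin n) n) → Alternating d σ → T (alternating d σ)
Alternating⇒alternating {n} d σ h = ∈-all _ (pairs n) λ { {i , j} _ → at i j }
  where
  at : ∀ i j → T (alternationTest d σ (i , j))
  at i j with toℕ j ≡ᵇ suc (toℕ i) in e
  ... | false = tt
  ... | true  = subst T (sym (adjacent-test d (toℕ i) (value σ i) (value σ j)))
                  (Alt⇒altᵇ _ (subst₂ (Alt (hasParity d (toℕ i))) (entry-value σ i) (trans (cong (entry σ) (sym adj)) (entry-value σ j))
                    (h (toℕ i) (subst (_< n) adj (Finₚ.toℕ<n j)))))
    where
    adj : toℕ j ≡ suc (toℕ i)
    adj = ℕₚ.≡ᵇ⇒≡ _ _ (≡true⇒T e)

unique-singleton : ∀ {A : Set} {t : A} (ys : List A) → Unique ys → (∀ {y} → y ∈ ys → y ≡ t) → t ∈ ys → ys ≡ [ t ]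
unique-singleton (y ∷ [])     _               only _ = cong [_] (only (here refl))
unique-singleton (y ∷ z ∷ ys) (y∉ ∷ _) only _ =
  ⊥-elim (All.lookup y∉ (here refl) (trans (only (here refl)) (sym (only (there (here refl))))))

count-xor-parity : ∀ {A : Set} (g h : A → Bool) xs →
  isEven (length (filterᵇ g xs) + length (filterᵇ h xs)) ≡ isEven (length (filterᵇ (λ x → g x xor h x) xs))
count-xor-parity g h [] = refl
count-xor-parity g h (x ∷ xs) with g x | h x
... | true  | true  = trans (isEven-+suc (suc (length (filterᵇ g xs))) _)
                        (trans (Boolₚ.not-involutive _) (count-xor-parity g h xs))
... | true  | false = cong not (count-xor-parity g h xs)
... | false | true  = trans (isEven-+suc (length (filterᵇ g xs)) _) (cong not (count-xor-parity g h xs))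
... | false | false = count-xor-parity g h xs

adjacent-oppParity : ∀ {n} (i j : Fin n) → toℕ j ≡ suc (toℕ i) → T (oppParity (i , j))
adjacent-oppParity i j adj rewrite adj | odd-test (toℕ i + suc (toℕ i)) | isEven-consecutive (toℕ i) = tt

-- When a is unlinked in a permutation σ, the swap s_a exchanges the values a, a+1 sitting at
-- positions of equal parity. It therefore keeps σ a permutation, keeps both alternation patterns
-- (adjacent positions have opposite parity), keeps L, and changes ℓ by exactly one inversion.
module UnlinkedSwap {n a} (σ : Vec (Fin n) n) (isσ : T (isPerm σ)) (unlinked : linked a σ ≡ false) (a<n : suc a < n) where

  σ′ : Vec (Fin n) n
  σ′ = swapValues a σ

  value′ : ∀ i → value σ′ i ≡ swapℕ a (value σ i)
  value′ i = value-swapValues a σ i a<n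

  no-pair-across : ∀ {i j} → (i , j) ∈ pairs n → T (oppParity (i , j)) → ¬ FormsPair a (value σ i) (value σ j)
  no-pair-across m opp pr =
    subst T unlinked (∈-any (linkedAt a σ) m (Equivalence.from Boolₚ.T-∧ (FormsPair⇒carriesPair a _ _ pr , opp)))

  altᵇ-kept : ∀ d {i j} → (i , j) ∈ pairs n → ¬ FormsPair a (value σ i) (value σ j) →
    altᵇ d (value σ′ i) (value σ′ j) ≡ altᵇ d (value σ i) (value σ j)
  altᵇ-kept true  {i} {j} m np rewrite value′ i | value′ j =
    swapℕ-preserves-< a _ _ (perm-distinct σ isσ m) np
  altᵇ-kept false {i} {j} m np rewrite value′ i | value′ j =
    swapℕ-preserves-< a _ _ (perm-distinct σ isσ m ∘ sym) (np ∘ FormsPair-sym)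

  isPerm-kept : T (isPerm σ′)
  isPerm-kept = ∈-all _ (pairs n) λ { {i , j} m → subst (T ∘ not)
    (sym (trans (cong₂ _≡ᵇ_ (value′ i) (value′ j)) (swapℕ-≡ᵇ a _ _))) (all-∈ _ (pairs n) isσ m) }

  alternating-kept : ∀ d → T (alternating d σ) → T (alternating d σ′)
  alternating-kept d = subst T (sym (cong and (Listₚ.map-cong-local {xs = pairs n} (All.tabulate λ { {i , j} m → same i j m }))))
    where
    same : ∀ i j → (i , j) ∈ pairs n → alternationTest d σ′ (i , j) ≡ alternationTest d σ (i , j)
    same i j m with toℕ j ≡ᵇ suc (toℕ i) in e
    ... | false = refl
    ... | true  = cong₂ (λ u v → if toℕ i % 2 ≡ᵇ 0 then u else v) (altᵇ-kept d m np) (altᵇ-kept (not d) m np)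
      where np = no-pair-across m (adjacent-oppParity i j (ℕₚ.≡ᵇ⇒≡ _ _ (≡true⇒T e)))

  L-kept : L σ′ ≡ L σ
  L-kept = cong length (filterᵇ-cong (pairs n) λ { {i , j} m → same i j m })
    where
    same : ∀ i j → (i , j) ∈ pairs n → (isInv σ′ (i , j) ∧ oppParity (i , j)) ≡ (isInv σ (i , j) ∧ oppParity (i , j))
    same i j m with oppParity (i , j) in e
    ... | false = trans (Boolₚ.∧-zeroʳ _) (sym (Boolₚ.∧-zeroʳ _))
    ... | true  = trans (Boolₚ.∧-identityʳ _)
                    (trans (altᵇ-kept true m (no-pair-across m (≡true⇒T e))) (sym (Boolₚ.∧-identityʳ _)))

  changed : Fin n × Fin n → Bool
  changed p = isInv σ′ p xor isInv σ p

  changed⇒FormsPair : ∀ {i j} → (i , j) ∈ pairs n → T (changed (i , j)) → FormsPair a (value σ i) (value σ j)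
  changed⇒FormsPair {i} {j} m t with T? (carriesPair a (value σ i) (value σ j))
  ... | yes c = carriesPair⇒FormsPair a _ _ c
  ... | no ¬c = ⊥-elim (subst T (trans (cong (_xor isInv σ (i , j)) (altᵇ-kept true m (¬c ∘ FormsPair⇒carriesPair a _ _)))
                                       (Boolₚ.xor-same (isInv σ (i , j)))) t)

  FormsPair⇒changed : ∀ {i j} → FormsPair a (value σ i) (value σ j) → T (changed (i , j))
  FormsPair⇒changed {i} {j} pr rewrite value′ i | value′ j | swapℕ-reverses-< a _ _ pr =
    subst T (sym (trans (sym (Boolₚ.not-distribˡ-xor b b)) (cong not (Boolₚ.xor-same b)))) tt
    where b = value σ j <ᵇ value σ i

  pair-positions-unique : ∀ {i j p q} → toℕ i < toℕ j → toℕ p < toℕ q →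
    FormsPair a (value σ i) (value σ j) → FormsPair a (value σ p) (value σ q) → (i , j) ≡ (p , q)
  pair-positions-unique _ _ (inj₁ (x , y)) (inj₁ (x′ , y′)) = cong₂ _,_ (injective x x′) (injective y y′)
    where injective : ∀ {i p v} → value σ i ≡ v → value σ p ≡ v → i ≡ p
          injective e e′ = perm-injective σ isσ (trans e (sym e′))
  pair-positions-unique _ _ (inj₂ (x , y)) (inj₂ (x′ , y′)) = cong₂ _,_ (injective x x′) (injective y y′)
    where injective : ∀ {i p v} → value σ i ≡ v → value σ p ≡ v → i ≡ p
          injective e e′ = perm-injective σ isσ (trans e (sym e′))
  pair-positions-unique i<j p<q (inj₁ (x , y)) (inj₂ (x′ , y′))
    with perm-injective σ isσ (trans x (sym y′)) | perm-injective σ isσ (trans y (sym x′))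
  ... | refl | refl = ⊥-elim (ℕₚ.<-asym i<j p<q)
  pair-positions-unique i<j p<q (inj₂ (x , y)) (inj₁ (x′ , y′))
    with perm-injective σ isσ (trans x (sym y′)) | perm-injective σ isσ (trans y (sym x′))
  ... | refl | refl = ⊥-elim (ℕₚ.<-asym i<j p<q)

  changedPairs : List (Fin n × Fin n)
  changedPairs = filterᵇ changed (pairs n)

  changedPairs-single : ∀ {p q} → toℕ p < toℕ q → FormsPair a (value σ p) (value σ q) → changedPairs ≡ [ (p , q) ]
  changedPairs-single {p} {q} p<q pr = unique-singleton changedPairs (Uniqueₚ.filter⁺ _ (pairs-unique n)) only
    (∈-filter⁺ (T? ∘ changed) (∈pairs⁺ p<q) (FormsPair⇒changed pr))
    where
    only : ∀ {y} → y ∈ changedPairs → y ≡ (p , q)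
    only {i , j} m with ∈-filter⁻ (T? ∘ changed) {xs = pairs n} m
    ... | mp , t = pair-positions-unique (∈pairs⁻ mp) p<q (changed⇒FormsPair mp t) pr

  position : ∀ v → v < n → ∃[ i ] (value σ i ≡ v)
  position v v<n with perm-surjective σ isσ (fromℕ< v<n)
  ... | i , e = i , trans (cong toℕ e) (Finₚ.toℕ-fromℕ< v<n)

  one-changed : length changedPairs ≡ 1
  one-changed with position a (ℕₚ.<-trans (ℕₚ.n<1+n a) a<n) | position (suc a) a<n
  ... | i , vi | j , vj with ℕₚ.<-cmp (toℕ i) (toℕ j)
  ... | tri< i<j _ _ = cong length (changedPairs-single i<j (inj₁ (vi , vj)))
  ... | tri≈ _ i≡j _ = ⊥-elim (ℕₚ.<⇒≢ (ℕₚ.n<1+n a) (trans (sym vi) (trans (cong (value σ) (Finₚ.toℕ-injective i≡j)) vj)))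
  ... | tri> _ _ j<i = cong length (changedPairs-single j<i (inj₂ (vj , vi)))

  ℓ-parity-flips : isEven (ℓ σ′ + ℓ σ) ≡ false
  ℓ-parity-flips = trans (count-xor-parity (isInv σ′) (isInv σ) (pairs n)) (cong isEven one-changed)

filter-subsumed : ∀ {A : Set} {P Q : A → Set} (P? : Decidable P) (Q? : Decidable Q) (ys : List A) →
  (∀ {y} → y ∈ ys → P y → Q y) → filter P? (filter Q? ys) ≡ filter P? ys
filter-subsumed P? Q? []       _ = refl
filter-subsumed {P = P} {Q} P? Q? (y ∷ ys) h = by-cases (P? y) (Q? y)
  where
  open ≡-Reasoning
  ih : filter P? (filter Q? ys) ≡ filter P? ys
  ih = filter-subsumed P? Q? ys (h ∘ there)
  by-cases : Dec (P y) → Dec (Q y) → filter P? (filter Q? (y ∷ ys)) ≡ filter P? (y ∷ ys)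
  by-cases (yes p) (yes q) = begin
    filter P? (filter Q? (y ∷ ys))    ≡⟨ cong (filter P?) (Listₚ.filter-accept Q? q) ⟩
    filter P? (y ∷ filter Q? ys)      ≡⟨ Listₚ.filter-accept P? p ⟩
    y ∷ filter P? (filter Q? ys)      ≡⟨ cong (y ∷_) ih ⟩
    y ∷ filter P? ys                  ≡⟨ Listₚ.filter-accept P? p ⟨
    filter P? (y ∷ ys)                ∎
  by-cases (yes p) (no ¬q) = ⊥-elim (¬q (h (here refl) p))
  by-cases (no ¬p) (yes q) = begin
    filter P? (filter Q? (y ∷ ys))    ≡⟨ cong (filter P?) (Listₚ.filter-accept Q? q) ⟩
    filter P? (y ∷ filter Q? ys)      ≡⟨ Listₚ.filter-reject P? ¬p ⟩
    filter P? (filter Q? ys)          ≡⟨ ih ⟩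
    filter P? ys                      ≡⟨ Listₚ.filter-reject P? ¬p ⟨
    filter P? (y ∷ ys)                ∎
  by-cases (no ¬p) (no ¬q) = begin
    filter P? (filter Q? (y ∷ ys))    ≡⟨ cong (filter P?) (Listₚ.filter-reject Q? ¬q) ⟩
    filter P? (filter Q? ys)          ≡⟨ ih ⟩
    filter P? ys                      ≡⟨ Listₚ.filter-reject P? ¬p ⟨
    filter P? (y ∷ ys)                ∎

module RingSums {c ℓ′ : Level} (R : CommutativeRing c ℓ′) where
  open CommutativeRing R using (Carrier; _≈_; 0#; 1#; -_; +-cong; +-assoc; +-comm; +-identityˡ; +-identityʳ;
    *-cong; *-identityˡ; *-identityʳ; -‿inverseʳ; -‿inverseˡ; ring; commutativeSemiring; +-commutativeSemigroup)
    renaming (_+_ to _+ᴿ_; _*_ to _*ᴿ_; refl to ≈-refl; sym to ≈-sym; trans to ≈-trans; reflexive to ≈-reflexive; setoid to ≈-setoid)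
  open import Relation.Binary.Reasoning.Setoid ≈-setoid
  open import Algebra.Properties.Ring ring using (-1*x≈-x; -‿involutive)
  open import Algebra.Properties.CommutativeSemiring.Exp commutativeSemiring using (_^_; ^-distrib-*; ^-congˡ)
  open import Algebra.Properties.CommutativeSemigroup +-commutativeSemigroup using (x∙yz≈y∙xz)

  sumᴿ : ∀ {A : Set} → (A → Carrier) → List A → Carrier
  sumᴿ f = foldr (λ a acc → f a +ᴿ acc) 0#

  sumᴿ-remove : ∀ {A : Set} (_≟_ : DecidableEquality A) (f : A → Carrier) (ys : List A) {y} → Unique ys → y ∈ ys →
    sumᴿ f ys ≈ f y +ᴿ sumᴿ f (filter (λ z → ¬? (z ≟ y)) ys)
  sumᴿ-remove _≟_ f (z ∷ zs) (z∉ ∷ _) (here refl) with z ≟ z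
  ... | yes _ = +-cong ≈-refl (≈-reflexive (cong (sumᴿ f)
                  (sym (Listₚ.filter-all (λ w → ¬? (w ≟ z)) (All.map (λ z≢w w≡z → z≢w (sym w≡z)) z∉)))))
  ... | no z≢z = ⊥-elim (z≢z refl)
  sumᴿ-remove _≟_ f (z ∷ zs) {y} (z∉ ∷ uzs) (there m) with z ≟ y
  ... | yes z≡y = ⊥-elim (All.lookup z∉ m z≡y)
  ... | no _    = begin
    f z +ᴿ sumᴿ f zs                                          ≈⟨ +-cong ≈-refl (sumᴿ-remove _≟_ f zs uzs m) ⟩
    f z +ᴿ (f y +ᴿ sumᴿ f (filter (λ w → ¬? (w ≟ y)) zs))      ≈⟨ x∙yz≈y∙xz _ _ _ ⟩
    f y +ᴿ (f z +ᴿ sumᴿ f (filter (λ w → ¬? (w ≟ y)) zs))      ∎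

  module Cancellation {A : Set} (_≟_ : DecidableEquality A) {Fixed : A → Set} (Fixed? : Decidable Fixed)
                      (ι : A → A) (f : A → Carrier) where

    PairsOff : List A → Set ℓ′
    PairsOff xs = ∀ {a} → a ∈ xs → ¬ Fixed a →
      (ι a ∈ xs) × (¬ Fixed (ι a)) × (ι (ι a) ≡ a) × (ι a ≢ a) × (f (ι a) +ᴿ f a ≈ 0#)

    -- By induction on a bound k for the length: remove a non-fixed head together with its partner.
    cancel : ∀ k xs → length xs ≤ k → Unique xs → PairsOff xs → sumᴿ f xs ≈ sumᴿ f (filter Fixed? xs)
    cancel k       []         _        _           _     = ≈-refl
    cancel (suc k) (a ∷ rest) (s≤s lk) (a∉ ∷ urest) pairs with Fixed? a
    ... | yes fa = +-cong ≈-refl (cancel k rest lk urest pairs′)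
      where
      pairs′ : PairsOff rest
      pairs′ m ¬fb with pairs (there m) ¬fb
      ... | here ιb≡a  , ¬fιb , rest′            = ⊥-elim (¬fιb (subst Fixed (sym ιb≡a) fa))
      ... | there ιb∈ , ¬fιb , ιιb , ιb≢b , sum₀ = ιb∈ , ¬fιb , ιιb , ιb≢b , sum₀
    ... | no ¬fa with pairs (here refl) ¬fa
    ...   | here ιa≡a , _ , _ , ιa≢a , _       = ⊥-elim (ιa≢a ιa≡a)
    ...   | there ιa∈ , ¬fιa , ιιa , _ , sum₀ = begin
      f a +ᴿ sumᴿ f rest                 ≈⟨ +-cong ≈-refl (sumᴿ-remove _≟_ f rest urest ιa∈) ⟩
      f a +ᴿ (f (ι a) +ᴿ sumᴿ f rest′)   ≈⟨ +-assoc _ _ _ ⟨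
      (f a +ᴿ f (ι a)) +ᴿ sumᴿ f rest′   ≈⟨ +-cong (≈-trans (+-comm _ _) sum₀) ≈-refl ⟩
      0# +ᴿ sumᴿ f rest′                 ≈⟨ +-identityˡ _ ⟩
      sumᴿ f rest′                       ≈⟨ cancel k rest′ (ℕₚ.≤-trans (Listₚ.length-filter _ rest) lk) (Uniqueₚ.filter⁺ _ urest) pairs′ ⟩
      sumᴿ f (filter Fixed? rest′)       ≡⟨ cong (sumᴿ f) (filter-subsumed Fixed? notPartner rest (λ _ fz e → ¬fιa (subst Fixed e fz))) ⟩
      sumᴿ f (filter Fixed? rest)        ∎
      where
      notPartner : Decidable (λ z → ¬ z ≡ ι a)
      notPartner z = ¬? (z ≟ ι a)
      rest′ : List A
      rest′ = filter notPartner rest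
      pairs′ : PairsOff rest′
      pairs′ {b} m ¬fb with ∈-filter⁻ notPartner {xs = rest} m
      ... | b∈ , b≢ιa with pairs (there b∈) ¬fb
      ... | here ιb≡a  , _ , ιιb , _ , _ = ⊥-elim (b≢ιa (trans (sym ιιb) (cong ι ιb≡a)))
      ... | there ιb∈ , ¬fιb , ιιb , ιb≢b , sum₁ =
        ∈-filter⁺ notPartner ιb∈ (λ ιb≡ιa → All.lookup a∉ b∈ (trans (sym ιιa) (trans (cong ι (sym ιb≡ιa)) ιιb))) ,
        ¬fιb , ιιb , ιb≢b , sum₁

  sign : ∀ k → (- 1#) ^ k ≈ (if isEven k then 1# else - 1#)
  sign zero = ≈-refl
  sign (suc k) with isEven k | sign k
  ... | true  | ih = ≈-trans (*-cong ≈-refl ih) (*-identityʳ _)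
  ... | false | ih = ≈-trans (*-cong ≈-refl ih) (≈-trans (-1*x≈-x _) (-‿involutive _))

  even-sign : ∀ k X → isEven k ≡ true → (- 1#) ^ k *ᴿ X ≈ X
  even-sign k X e with isEven k | sign k
  ... | true | s = ≈-trans (*-cong s ≈-refl) (*-identityˡ X)

  opposite-signs-cancel : ∀ u v X → isEven (u + v) ≡ false → (- 1#) ^ u *ᴿ X +ᴿ (- 1#) ^ v *ᴿ X ≈ 0#
  opposite-signs-cancel u v X odd with isEven u | isEven v | sign u | sign v | isEven-+ u v
  ... | true  | true  | _  | _  | e = ⊥-elim (true≢false (trans (sym e) odd))
  ... | false | false | _  | _  | e = ⊥-elim (true≢false (trans (sym e) odd))
  ... | true  | false | su | sv | _ = begin
    (- 1#) ^ u *ᴿ X +ᴿ (- 1#) ^ v *ᴿ X  ≈⟨ +-cong (*-cong su ≈-refl) (*-cong sv ≈-refl) ⟩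
    1# *ᴿ X +ᴿ (- 1#) *ᴿ X              ≈⟨ +-cong (*-identityˡ X) (-1*x≈-x X) ⟩
    X +ᴿ (- X)                          ≈⟨ -‿inverseʳ X ⟩
    0#                                  ∎
  ... | false | true  | su | sv | _ = begin
    (- 1#) ^ u *ᴿ X +ᴿ (- 1#) ^ v *ᴿ X  ≈⟨ +-cong (*-cong su ≈-refl) (*-cong sv ≈-refl) ⟩
    (- 1#) *ᴿ X +ᴿ 1# *ᴿ X              ≈⟨ +-cong (-1*x≈-x X) (*-identityˡ X) ⟩
    (- X) +ᴿ X                          ≈⟨ -‿inverseˡ X ⟩
    0#                                  ∎

  sign-power : ∀ x m → (- 1#) ^ m *ᴿ x ^ m ≈ (- x) ^ m
  sign-power x m = begin
    (- 1#) ^ m *ᴿ x ^ m  ≈⟨ ^-distrib-* (- 1#) x m ⟨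
    ((- 1#) *ᴿ x) ^ m    ≈⟨ ^-congˡ m (-1*x≈-x x) ⟩
    (- x) ^ m            ∎

module Involution (d p : Bool) (n : ℕ) where

  E : List (Vec (Fin n) n)
  E = filterᵇ (alternating d) (Sym n)

  ∈E⁻ : ∀ {σ} → σ ∈ E → T (isPerm σ) × T (alternating d σ)
  ∈E⁻ m with ∈-filter⁻ (T? ∘ alternating d) {xs = Sym n} m
  ... | m′ , alt = proj₂ (∈-filter⁻ (T? ∘ isPerm) {xs = allVecs n n} m′) , alt

  ∈E⁺ : ∀ {σ} → T (isPerm σ) → T (alternating d σ) → σ ∈ E
  ∈E⁺ {σ} isσ alt = ∈-filter⁺ (T? ∘ alternating d) (∈-filter⁺ (T? ∘ isPerm) (∈allVecs n n σ) isσ) alt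

  E-unique : Unique E
  E-unique = Uniqueₚ.filter⁺ _ (Uniqueₚ.filter⁺ _ (allVecs-unique n n))

  Fixed : Vec (Fin n) n → Set
  Fixed σ = firstUnlinked σ (candidates p n) ≡ nothing

  Fixed? : Decidable Fixed
  Fixed? σ with firstUnlinked σ (candidates p n)
  ... | nothing = yes refl
  ... | just _  = no λ ()

  fixed⇒linked : ∀ {σ} → Fixed σ → ∀ {a} → a ∈ candidates p n → T (linked a σ)
  fixed⇒linked {σ} = firstUnlinked-nothing⁻ σ (candidates p n)

  non-fixed : ∀ {σ} → σ ∈ E → ¬ Fixed σ →
    (ι p σ ∈ E) × (¬ Fixed (ι p σ)) × (ι p (ι p σ) ≡ σ) × (ι p σ ≢ σ) ×
    (isEven (ℓ (ι p σ) + ℓ σ) ≡ false) × (L (ι p σ) ≡ L σ)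
  non-fixed {σ} m ¬fixed with firstUnlinked σ (candidates p n) in eq
  ... | nothing = ⊥-elim (¬fixed refl)
  ... | just a  =
    ∈E⁺ isPerm-kept (alternating-kept d (proj₂ (∈E⁻ m))) , ¬fixed′ ,
    subst (λ z → applySwap (firstUnlinked (applySwap z σ) (candidates p n)) (applySwap z σ) ≡ σ) eq (ι-involutive p σ) ,
    moved , ℓ-parity-flips , L-kept
    where
    unlinked = firstUnlinked-just σ (candidates p n) eq
    isσ = proj₁ (∈E⁻ m)
    open UnlinkedSwap σ isσ (proj₂ unlinked) (proj₂ (∈candidates⁻ {p} {n} {a} (proj₁ unlinked)))
    ¬fixed′ : ¬ Fixed σ′
    ¬fixed′ fixed′ with trans (sym (trans (firstUnlinked-cong σ′ σ (candidates p n) (linked-swapValues σ (proj₁ unlinked))) eq)) fixed′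
    ... | ()
    moved : σ′ ≢ σ
    moved e = true≢false (trans (sym (isEven-double (ℓ σ))) (trans (cong (λ τ → isEven (ℓ τ + ℓ σ)) (sym e)) ℓ-parity-flips))

module Reduction {c ℓ′ : Level} (R : CommutativeRing c ℓ′) (x : CommutativeRing.Carrier R) (d p : Bool) (n : ℕ) where
  open CommutativeRing R using (Carrier; _≈_; 0#; 1#; -_; +-identityʳ)
    renaming (_+_ to _+ᴿ_; _*_ to _*ᴿ_; trans to ≈-trans; reflexive to ≈-reflexive)
  open RingSums R
  open Involution d p n

  weight : Vec (Fin n) n → Carrier
  weight σ = pow R (- 1#) (ℓ σ) *ᴿ pow R x (L σ)

  reduce : sumᴿ weight E ≈ sumᴿ weight (filter Fixed? E)
  reduce = cancel (length E) E ℕₚ.≤-refl E-unique pairs-off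
    where
    open Cancellation (Vecₚ.≡-dec Finₚ._≟_) Fixed? (ι p) weight
    pairs-off : PairsOff E
    pairs-off {σ} m ¬fixed with non-fixed m ¬fixed
    ... | ισ∈ , ¬fixed′ , invol , moved , parity , L-same = ισ∈ , ¬fixed′ , invol , moved ,
      subst (λ k → pow R (- 1#) (ℓ (ι p σ)) *ᴿ pow R x k +ᴿ weight σ ≈ 0#) (sym L-same)
        (opposite-signs-cancel (ℓ (ι p σ)) (ℓ σ) (pow R x (L σ)) parity)

  sum-single-fixed : ∀ {t} → (∀ {σ} → σ ∈ E → Fixed σ → σ ≡ t) → t ∈ E → Fixed t → sumᴿ weight E ≈ weight t
  sum-single-fixed {t} only t∈ fixed = ≈-trans reduce (≈-trans (≈-reflexive (cong (sumᴿ weight) fixed-points)) (+-identityʳ (weight t)))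
    where
    fixed-points : filter Fixed? E ≡ [ t ]
    fixed-points = unique-singleton (filter Fixed? E) (Uniqueₚ.filter⁺ Fixed? E-unique)
      (λ m → let m₁ , m₂ = ∈-filter⁻ Fixed? {xs = E} m in only m₁ m₂) (∈-filter⁺ Fixed? t∈ fixed)

  sum-no-fixed : (∀ {σ} → σ ∈ E → ¬ Fixed σ) → sumᴿ weight E ≈ 0#
  sum-no-fixed none = ≈-trans reduce (≈-reflexive (cong (sumᴿ weight) (Listₚ.filter-none Fixed? (All.tabulate none))))

halve : ∀ v → ∃[ k ] (v ≡ k + k ⊎ v ≡ suc (k + k))
halve zero          = 0 , inj₁ refl
halve (suc zero)    = 0 , inj₂ refl
halve (suc (suc v)) with halve v
... | k , inj₁ e = suc k , inj₁ (trans (cong (suc ∘ suc) e) (cong suc (sym (ℕₚ.+-suc k k))))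
... | k , inj₂ e = suc k , inj₂ (trans (cong (suc ∘ suc) e) (cong (suc ∘ suc) (sym (ℕₚ.+-suc k k))))

double-< : ∀ {k′ k} → k′ < k → suc (k′ + k′) < k + k
double-< {k′} {k} lt = subst (_≤ k + k) (cong suc (ℕₚ.+-suc k′ k′)) (ℕₚ.+-mono-≤ lt lt)

double-<⁻ : ∀ {k′ k} → k′ + k′ < k + k → k′ < k
double-<⁻ {k′} {k} lt with k′ ℕₚ.<? k
... | yes k′<k = k′<k
... | no  k′≮k = ⊥-elim (ℕₚ.<⇒≱ lt (ℕₚ.+-mono-≤ (ℕₚ.≮⇒≥ k′≮k) (ℕₚ.≮⇒≥ k′≮k)))

even-below-even : ∀ {i n} → i < n → isEven i ≡ isEven n → suc i < n
even-below-even {i} lt same with ℕₚ.m≤n⇒m<n∨m≡n lt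
... | inj₁ si<n = si<n
... | inj₂ refl = ⊥-elim (Boolₚ.not-¬ refl same)

odd-sum : ∀ i j → isEven (i + j) ≡ false → isEven j ≡ not (isEven i)
odd-sum i j odd with isEven i | isEven j | isEven-+ i j
... | true  | _     | e = trans (sym e) odd
... | false | true  | e = refl
... | false | false | e = ⊥-elim (true≢false (trans (sym e) odd))

hasParity-not : ∀ d i → hasParity (not d) i ≡ not (hasParity d i)
hasParity-not true  i = refl
hasParity-not false i = sym (Boolₚ.not-involutive (isEven i))

-- The shape of the entries of a permutation in E: an injective map [0,n) → [0,n)
-- alternating with pattern d.
record AltMap (n : ℕ) (d : Bool) : Set where
  field
    f          : ℕ → ℕ
    bounded    : ∀ i → i < n → f i < n
    injective  : ∀ {i j} → i < n → j < n → f i ≡ f j → i ≡ j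
    alternates : ∀ i → suc i < n → Alt (hasParity d i) (f i) (f (suc i))

LinkedIn : (ℕ → ℕ) → ℕ → ℕ → Set
LinkedIn f n a = ∃[ i ] ∃[ j ] (i < n × j < n × isEven (i + j) ≡ false × f i ≡ a × f j ≡ suc a)

mirror : ℕ → ℕ → ℕ
mirror n v = n ∸ suc v

mirror-< : ∀ {n v} → v < n → mirror n v < n
mirror-< {n} {v} lt = ℕₚ.∸-monoʳ-< {n} {suc v} {0} (s≤s z≤n) lt

mirror-involutive : ∀ {n v} → v < n → mirror n (mirror n v) ≡ v
mirror-involutive {suc n} {v} (s≤s v≤n) = trans (cong (suc n ∸_) (sym (ℕₚ.+-∸-assoc 1 v≤n))) (ℕₚ.m∸[m∸n]≡n (ℕₚ.m≤n⇒m≤1+n v≤n))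

mirror-reverses : ∀ {n x y} → x < y → y < n → mirror n y < mirror n x
mirror-reverses x<y y<n = ℕₚ.∸-monoʳ-< (s≤s x<y) y<n

mirror-injective : ∀ {n x y} → x < n → y < n → mirror n x ≡ mirror n y → x ≡ y
mirror-injective {n} x<n y<n e = trans (sym (mirror-involutive x<n)) (trans (cong (mirror n) e) (mirror-involutive y<n))

mirror-suc : ∀ {n a} → suc a < n → suc (mirror n (suc a)) ≡ mirror n a
mirror-suc {suc n} (s≤s a<n) = sym (ℕₚ.+-∸-assoc 1 a<n)

mirror-Alt : ∀ {n} b {x y} → x < n → y < n → Alt b x y → Alt (not b) (mirror n x) (mirror n y)
mirror-Alt true  x<n y<n y<x = mirror-reverses y<x x<n
mirror-Alt false x<n y<n x<y = mirror-reverses x<y y<n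

mirrorMap : ∀ {n d} → AltMap n d → AltMap n (not d)
mirrorMap {n} {d} A = record
  { f          = mirror n ∘ f
  ; bounded    = λ i i<n → mirror-< (bounded i i<n)
  ; injective  = λ i<n j<n e → injective i<n j<n (mirror-injective (bounded _ i<n) (bounded _ j<n) e)
  ; alternates = λ i si<n → subst (λ b → Alt b (mirror n (f i)) (mirror n (f (suc i)))) (sym (hasParity-not d i))
      (mirror-Alt (hasParity d i) (bounded i (ℕₚ.<-trans (ℕₚ.n<1+n i) si<n)) (bounded (suc i) si<n) (alternates i si<n))
  }
  where open AltMap A

LinkedIn-mirror : ∀ {f n a} → suc a < n → LinkedIn f n a → LinkedIn (mirror n ∘ f) n (mirror n (suc a))
LinkedIn-mirror {f} {n} {a} sa<n (i , j , i<n , j<n , odd , fi , fj) =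
  j , i , j<n , i<n , trans (cong isEven (ℕₚ.+-comm j i)) odd , cong (mirror n) fj ,
  trans (cong (mirror n) fi) (sym (mirror-suc sa<n))

-- The involution 0↔1, 2↔3, …: the entries of the unique fixed point in E⁻ for even n.
zigzag : ℕ → ℕ
zigzag i = if isEven i then suc i else pred i

-- By strong induction on k: if positions below 2k
-- carry the values below 2k (blockwise zigzag), the link at 2k forces f(2k) = 2k+1, f(2k+1) = 2k.
module DownUpZigzag {n} (A : AltMap n true) (n-even : isEven n ≡ true)
                    (linked-even : ∀ k → suc (k + k) < n → LinkedIn (AltMap.f A) n (k + k)) where
  open AltMap A

  Block : ℕ → Set
  Block k = f (k + k) ≡ suc (k + k) × f (suc (k + k)) ≡ k + k

  followed : ∀ {i} → isEven i ≡ true → i < n → suc i < n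
  followed e i<n = even-below-even i<n (trans e (sym n-even))

  descent : ∀ i → isEven i ≡ true → suc i < n → f (suc i) < f i
  descent i e si<n = subst (λ b → Alt b (f i) (f (suc i))) e (alternates i si<n)

  ascent : ∀ i → isEven i ≡ false → suc i < n → f i < f (suc i)
  ascent i e si<n = subst (λ b → Alt b (f i) (f (suc i))) e (alternates i si<n)

  squeeze : ∀ {K x} → K ≤ x → x < suc K → x ≡ K
  squeeze K≤x x<sK = ℕₚ.≤-antisym (ℕₚ.≤-pred x<sK) K≤x

  block-step : ∀ k → suc (k + k) < n → (∀ {k′} → k′ < k → Block k′) → Block k
  block-step k bound below with linked-even k bound
  ... | i , j , i<n , j<n , odd , fi , fj = link-position (isEven i) refl
    where
    K = k + k
    K<n = ℕₚ.<-trans (ℕₚ.n<1+n K) bound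

    low-values : ∀ i → i < K → f i < K
    low-values i i<K with halve i
    ... | k′ , inj₁ refl = subst (_< K) (sym (proj₁ (below k′<k))) (double-< k′<k)
      where k′<k = double-<⁻ {k′} {k} i<K
    ... | k′ , inj₂ refl = subst (_< K) (sym (proj₂ (below k′<k))) (ℕₚ.<-trans (ℕₚ.n<1+n _) (double-< k′<k))
      where k′<k = double-<⁻ {k′} {k} (ℕₚ.<-trans (ℕₚ.n<1+n _) i<K)

    low-positions : ∀ i → i < n → f i < K → i < K
    low-positions i i<n fi<K with halve (f i)
    ... | k′ , inj₁ e = subst (_< K) (injective (ℕₚ.<-trans (double-< k′<k) K<n) i<n (trans (proj₂ (below k′<k)) (sym e)))
                          (double-< k′<k)
      where k′<k = double-<⁻ {k′} {k} (subst (_< K) e fi<K)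
    ... | k′ , inj₂ e = subst (_< K) (injective (ℕₚ.<-trans (ℕₚ.<-trans (ℕₚ.n<1+n _) (double-< k′<k)) K<n) i<n
                                       (trans (proj₁ (below k′<k)) (sym e)))
                          (ℕₚ.<-trans (ℕₚ.n<1+n _) (double-< k′<k))
      where k′<k = double-<⁻ {k′} {k} (ℕₚ.<-trans (ℕₚ.n<1+n _) (subst (_< K) e fi<K))

    high : ∀ i → K ≤ f i → K ≤ i
    high i K≤fi = ℕₚ.≮⇒≥ (λ i<K → ℕₚ.<⇒≱ (low-values i i<K) K≤fi)

    not-low : ∀ i → i < n → K ≤ i → K ≤ f i
    not-low i i<n K≤i = ℕₚ.≮⇒≥ (λ fi<K → ℕₚ.<⇒≱ (low-positions i i<n fi<K) K≤i)

    K≤i : K ≤ i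
    K≤i = high i (ℕₚ.≤-reflexive (sym fi))

    K≤j : K ≤ j
    K≤j = high j (ℕₚ.≤-trans (ℕₚ.n≤1+n K) (ℕₚ.≤-reflexive (sym fj)))

    -- K cannot sit at an even position: the descent after it would lead below K …
    link-position : ∀ b → isEven i ≡ b → Block k
    link-position true ei = ⊥-elim (ℕₚ.<⇒≱ (low-positions (suc i) si<n (subst (f (suc i) <_) fi (descent i ei si<n)))
                                            (ℕₚ.≤-trans K≤i (ℕₚ.n≤1+n i)))
      where si<n = followed ei i<n
    -- … so K sits at the odd position i and K+1 at the even position j; the descent after j
    -- forces i = j+1, and the ascent before j (if j > K) would force i = j-1.
    link-position false ei = subst (λ z → f z ≡ suc K) j≡K fj , subst (λ z → f (suc z) ≡ K) j≡K f[sj]≡K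
      where
      ej : isEven j ≡ true
      ej = trans (odd-sum i j odd) (cong not ei)
      sj<n = followed ej j<n
      f[sj]≡K : f (suc j) ≡ K
      f[sj]≡K = squeeze (not-low (suc j) sj<n (ℕₚ.≤-trans K≤j (ℕₚ.n≤1+n j))) (subst (f (suc j) <_) fj (descent j ej sj<n))
      sj≡i : suc j ≡ i
      sj≡i = injective sj<n i<n (trans f[sj]≡K (sym fi))
      no-later : ∀ j → K < j → j < n → isEven j ≡ true → f j ≡ suc K → suc j ≡ i → ⊥
      no-later (suc j′) (s≤s K≤j′) j<n ej fj sj≡i =
        ℕₚ.<⇒≢ (ℕₚ.<-trans (ℕₚ.n<1+n j′) (ℕₚ.n<1+n (suc j′))) (trans j′≡i (sym sj≡i))
        where
        f[j′]≡K = squeeze (not-low j′ (ℕₚ.<-trans (ℕₚ.n<1+n j′) j<n) K≤j′)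
                    (subst (f j′ <_) fj (ascent j′ (trans (sym (Boolₚ.not-involutive _)) (cong not ej)) j<n))
        j′≡i = injective (ℕₚ.<-trans (ℕₚ.n<1+n j′) j<n) i<n (trans f[j′]≡K (sym fi))
      j≡K : j ≡ K
      j≡K with ℕₚ.m≤n⇒m<n∨m≡n K≤j
      ... | inj₁ K<j = ⊥-elim (no-later j K<j j<n ej fj sj≡i)
      ... | inj₂ K≡j = sym K≡j

  blocks : ∀ k → suc (k + k) < n → Block k
  blocks = <-rec (λ k → suc (k + k) < n → Block k)
    (λ k rec bound → block-step k bound (λ k′<k → rec k′<k (ℕₚ.<-trans (double-< k′<k) (ℕₚ.<-trans (ℕₚ.n<1+n _) bound))))

  is-zigzag : ∀ i → i < n → f i ≡ zigzag i
  is-zigzag i i<n with halve i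
  ... | k , inj₁ refl rewrite isEven-double k = proj₁ (blocks k (followed (isEven-double k) i<n))
  ... | k , inj₂ refl rewrite isEven-double k = proj₂ (blocks k i<n)

-- For odd n, an alternating map of pattern false (descents at odd positions) never links 0:
-- 0 cannot sit at an odd position (a descent follows it), and at an even position it would
-- have to sit both right before and right after the odd position of 1.
upDown-odd-unlinked : ∀ {n} (A : AltMap n false) → isEven n ≡ false → ¬ LinkedIn (AltMap.f A) n 0
upDown-odd-unlinked {n} A n-odd (i , j , i<n , j<n , odd , fi , fj) = by-parity (isEven i) refl
  where
  open AltMap A
  followed : ∀ {i} → isEven i ≡ false → i < n → suc i < n
  followed e i<n = even-below-even i<n (trans e (sym n-odd))
  descent : ∀ i → isEven i ≡ false → suc i < n → f (suc i) < f i
  descent i e si<n = subst (λ b → Alt b (f i) (f (suc i))) (cong not e) (alternates i si<n)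
  ascent : ∀ i → isEven i ≡ true → suc i < n → f i < f (suc i)
  ascent i e si<n = subst (λ b → Alt b (f i) (f (suc i))) (cong not e) (alternates i si<n)
  below-one : ∀ {x} → x < 1 → x ≡ 0
  below-one (s≤s z≤n) = refl
  by-parity : ∀ b → isEven i ≡ b → ⊥
  by-parity false ei with subst (f (suc i) <_) fi (descent i ei (followed ei i<n))
  ... | ()
  by-parity true ei = around j j<n (trans (odd-sum i j odd) (cong not ei)) fj
    where
    around : ∀ j → j < n → isEven j ≡ false → f j ≡ 1 → ⊥
    around (suc j′) j<n ej fj = ℕₚ.<⇒≢ (ℕₚ.<-trans (ℕₚ.n<1+n j′) (ℕₚ.n<1+n (suc j′))) (trans j′≡i i≡ssj′)
      where
      j′<n = ℕₚ.<-trans (ℕₚ.n<1+n j′) j<n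
      ssj′<n = followed ej j<n
      j′≡i = injective j′<n i<n (trans (below-one (subst (f j′ <_) fj (ascent j′ (trans (sym (Boolₚ.not-involutive _)) (cong not ej)) j<n))) (sym fi))
      i≡ssj′ = injective i<n ssj′<n (trans fi (sym (below-one (subst (f (suc (suc j′)) <_) fj (descent (suc j′) ej ssj′<n)))))

zigzag-even : ∀ i → isEven i ≡ true → zigzag i ≡ suc i
zigzag-even i e rewrite e = refl

zigzag-odd : ∀ i → isEven i ≡ false → zigzag i ≡ pred i
zigzag-odd i e rewrite e = refl

suc-even≢pred-odd : ∀ i j → isEven i ≡ true → isEven j ≡ false → suc i ≢ pred j
suc-even≢pred-odd i (suc j) ei ej refl = true≢false (trans (sym ei) (trans (sym (Boolₚ.not-involutive _)) ej))

zigzag-injective : ∀ {i j} → zigzag i ≡ zigzag j → i ≡ j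
zigzag-injective {i} {j} e with isEven i in ei | isEven j in ej
... | true  | true  = ℕₚ.suc-injective e
... | false | false = pred-injective i j ei ej e
  where
  pred-injective : ∀ i j → isEven i ≡ false → isEven j ≡ false → pred i ≡ pred j → i ≡ j
  pred-injective (suc i) (suc j) _ _ e = cong suc e
... | true  | false = ⊥-elim (suc-even≢pred-odd i j ei ej e)
... | false | true  = ⊥-elim (suc-even≢pred-odd j i ej ei (sym e))

zigzagMap : ∀ {n} → isEven n ≡ true → AltMap n true
zigzagMap {n} n-even = record
  { f          = zigzag
  ; bounded    = bounded
  ; injective  = λ _ _ → zigzag-injective
  ; alternates = alternates
  }
  where
  bounded : ∀ i → i < n → zigzag i < n
  bounded i i<n with isEven i in ei
  ... | true  = even-below-even i<n (trans ei (sym n-even))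
  ... | false = ℕₚ.≤-<-trans ℕₚ.pred[n]≤n i<n
  alternates : ∀ i → suc i < n → Alt (hasParity true i) (zigzag i) (zigzag (suc i))
  alternates i _ with isEven i
  ... | true  = ℕₚ.n<1+n i
  ... | false = ℕₚ.<-trans (ℕₚ.≤-<-trans ℕₚ.pred[n]≤n (ℕₚ.n<1+n i)) (ℕₚ.n<1+n (suc i))

zigzag-links : ∀ {n a} → isEven a ≡ true → suc a < n → LinkedIn zigzag n a
zigzag-links {n} {a} ea sa<n = suc a , a , sa<n , ℕₚ.<-trans (ℕₚ.n<1+n a) sa<n ,
  trans (cong isEven (ℕₚ.+-comm (suc a) a)) (isEven-consecutive a) ,
  zigzag-odd (suc a) (cong not ea) , zigzag-even a ea

even-sum : ∀ b c → isEven (b + c) ≡ true → isEven b ≡ isEven c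
even-sum b c e with isEven b | isEven c | isEven-+ b c
... | true  | true  | _ = refl
... | false | false | _ = refl
... | true  | false | e′ = ⊥-elim (true≢false (trans (sym e) e′))
... | false | true  | e′ = ⊥-elim (true≢false (trans (sym e) e′))

mirror-parity : ∀ {n a} → isEven n ≡ true → suc a < n → isEven (mirror n (suc a)) ≡ isEven a
mirror-parity {n} {a} n-even sa<n =
  trans (even-sum (mirror n (suc a)) (suc (suc a)) (trans (cong isEven (ℕₚ.m∸n+n≡m sa<n)) n-even)) (Boolₚ.not-involutive (isEven a))

LinkedIn-mirrored : ∀ {f n a} → suc a < n → LinkedIn f n (mirror n (suc a)) → LinkedIn (mirror n ∘ f) n a
LinkedIn-mirrored {f} {n} {a} sa<n link = subst (LinkedIn (mirror n ∘ f) n) reflected (LinkedIn-mirror b<n link)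
  where
  b<n : suc (mirror n (suc a)) < n
  b<n = subst (_< n) (sym (mirror-suc sa<n)) (mirror-< (ℕₚ.<-trans (ℕₚ.n<1+n a) sa<n))
  reflected : mirror n (suc (mirror n (suc a))) ≡ a
  reflected = trans (cong (mirror n) (mirror-suc sa<n)) (mirror-involutive (ℕₚ.<-trans (ℕₚ.n<1+n a) sa<n))

entryMap : ∀ {n} d (σ : Vec (Fin n) n) → T (isPerm σ) → T (alternating d σ) → AltMap n d
entryMap d σ isσ alt = record
  { f          = entry σ
  ; bounded    = entry-bound σ
  ; injective  = perm-injectiveℕ σ isσ
  ; alternates = alternating⇒Alternating d σ alt
  }

mapVec : ∀ {n d} → AltMap n d → Vec (Fin n) n
mapVec {n} A = fromEntries n f bounded
  where open AltMap A

entry-mapVec : ∀ {n d} (A : AltMap n d) → ∀ i → i < n → entry (mapVec A) i ≡ AltMap.f A i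
entry-mapVec {n} A = entry-fromEntries n f bounded
  where open AltMap A

mapVec-perm : ∀ {n d} (A : AltMap n d) → T (isPerm (mapVec A))
mapVec-perm A = isPerm⁺ (mapVec A) λ {i} {j} i<j j<n e →
  ℕₚ.<⇒≢ i<j (injective (ℕₚ.<-trans i<j j<n) j<n (trans (sym (entry-mapVec A i (ℕₚ.<-trans i<j j<n))) (trans e (entry-mapVec A j j<n))))
  where open AltMap A

mapVec-alternating : ∀ {n d} (A : AltMap n d) → T (alternating d (mapVec A))
mapVec-alternating {n} {d} A = Alternating⇒alternating d (mapVec A) λ k sk<n →
  subst₂ (Alt (hasParity d k)) (sym (entry-mapVec A k (ℕₚ.<-trans (ℕₚ.n<1+n k) sk<n))) (sym (entry-mapVec A (suc k) sk<n))
    (AltMap.alternates A k sk<n)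

linked⇒LinkedIn : ∀ {n} a (σ : Vec (Fin n) n) → T (linked a σ) → LinkedIn (entry σ) n a
linked⇒LinkedIn {n} a σ t with any-∈ (linkedAt a σ) (pairs n) t
... | (i , j) , _ , u with Equivalence.to Boolₚ.T-∧ u
... | c , opp with carriesPair⇒FormsPair a _ _ c
... | inj₁ (vi , vj) = toℕ i , toℕ j , Finₚ.toℕ<n i , Finₚ.toℕ<n j , odd ,
                       trans (entry-value σ i) vi , trans (entry-value σ j) vj
  where odd = Equivalence.to Boolₚ.T-not-≡ (subst T (odd-test (toℕ i + toℕ j)) opp)
... | inj₂ (vi , vj) = toℕ j , toℕ i , Finₚ.toℕ<n j , Finₚ.toℕ<n i , trans (cong isEven (ℕₚ.+-comm (toℕ j) (toℕ i))) odd ,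
                       trans (entry-value σ j) vj , trans (entry-value σ i) vi
  where odd = Equivalence.to Boolₚ.T-not-≡ (subst T (odd-test (toℕ i + toℕ j)) opp)

ordered-link⇒linked : ∀ {n} a (σ : Vec (Fin n) n) {i j} → i < j → j < n → isEven (i + j) ≡ false →
  FormsPair a (entry σ i) (entry σ j) → T (linked a σ)
ordered-link⇒linked {n} a σ {i} {j} i<j j<n odd pr =
  ∈-any (linkedAt a σ) (∈pairs⁺ (subst₂ _<_ (sym (Finₚ.toℕ-fromℕ< i<n)) (sym (Finₚ.toℕ-fromℕ< j<n)) i<j))
    (Equivalence.from Boolₚ.T-∧ (FormsPair⇒carriesPair a _ _ (subst₂ (FormsPair a) (entry-fromℕ< σ i i<n) (entry-fromℕ< σ j j<n) pr) , opp))
  where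
  i<n = ℕₚ.<-trans i<j j<n
  opp : T (oppParity (fromℕ< i<n , fromℕ< j<n))
  opp = subst T (sym (trans (odd-test (toℕ (fromℕ< i<n) + toℕ (fromℕ< j<n)))
                            (cong (not ∘ isEven) (cong₂ _+_ (Finₚ.toℕ-fromℕ< i<n) (Finₚ.toℕ-fromℕ< j<n)))))
          (Equivalence.from Boolₚ.T-not-≡ odd)

LinkedIn⇒linked : ∀ {n} a (σ : Vec (Fin n) n) → LinkedIn (entry σ) n a → T (linked a σ)
LinkedIn⇒linked {n} a σ (i , j , i<n , j<n , odd , vi , vj) with ℕₚ.<-cmp i j
... | tri< i<j _ _  = ordered-link⇒linked a σ i<j j<n odd (inj₁ (vi , vj))
... | tri≈ _ refl _ = ⊥-elim (ℕₚ.<⇒≢ (ℕₚ.n<1+n a) (trans (sym vi) vj))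
... | tri> _ _ j<i  = ordered-link⇒linked a σ j<i i<n (trans (cong isEven (ℕₚ.+-comm j i)) odd) (inj₂ (vj , vi))

LinkedIn-cong : ∀ {f g n a} → (∀ i → i < n → f i ≡ g i) → LinkedIn f n a → LinkedIn g n a
LinkedIn-cong same (i , j , i<n , j<n , odd , fi , fj) =
  i , j , i<n , j<n , odd , trans (sym (same i i<n)) fi , trans (sym (same j j<n)) fj

mirror-candidate : ∀ {n a} → suc a < n → suc (mirror n (suc a)) < n
mirror-candidate {n} {a} sa<n = subst (_< n) (sym (mirror-suc sa<n)) (mirror-< (ℕₚ.<-trans (ℕₚ.n<1+n a) sa<n))

module EvenFixedPoints (n : ℕ) (n-even : isEven n ≡ true) where
  module I⁻ = Involution true true n
  module I⁺ = Involution false true n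

  even-candidate : ∀ k → suc (k + k) < n → k + k ∈ candidates true n
  even-candidate k bound = ∈candidates⁺ {true} {n} {k + k} (≡true⇒T (isEven-double k)) bound

  zig : AltMap n true
  zig = zigzagMap n-even

  zag : AltMap n false
  zag = mirrorMap zig

  τ⁻ : Vec (Fin n) n
  τ⁻ = mapVec zig

  τ⁻∈E : τ⁻ ∈ I⁻.E
  τ⁻∈E = I⁻.∈E⁺ (mapVec-perm zig) (mapVec-alternating zig)

  τ⁻-fixed : I⁻.Fixed τ⁻
  τ⁻-fixed = firstUnlinked-nothing⁺ τ⁻ (candidates true n) λ {a} m →
    let even , sa<n = ∈candidates⁻ {true} {n} {a} m in
    LinkedIn⇒linked a τ⁻ (LinkedIn-cong (λ i i<n → sym (entry-mapVec zig i i<n)) (zigzag-links (T⇒≡true even) sa<n))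

  τ⁻-unique : ∀ {σ} → σ ∈ I⁻.E → I⁻.Fixed σ → σ ≡ τ⁻
  τ⁻-unique {σ} m fixed = entry-ext σ τ⁻ λ i i<n → trans (is-zigzag i i<n) (sym (entry-mapVec zig i i<n))
    where
    open DownUpZigzag (entryMap true σ (proj₁ (I⁻.∈E⁻ m)) (proj₂ (I⁻.∈E⁻ m))) n-even
      (λ k bound → linked⇒LinkedIn (k + k) σ (I⁻.fixed⇒linked fixed (even-candidate k bound)))

  τ⁺ : Vec (Fin n) n
  τ⁺ = mapVec zag

  τ⁺∈E : τ⁺ ∈ I⁺.E
  τ⁺∈E = I⁺.∈E⁺ (mapVec-perm zag) (mapVec-alternating zag)

  τ⁺-fixed : I⁺.Fixed τ⁺
  τ⁺-fixed = firstUnlinked-nothing⁺ τ⁺ (candidates true n) λ {a} m →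
    let even , sa<n = ∈candidates⁻ {true} {n} {a} m in
    LinkedIn⇒linked a τ⁺ (LinkedIn-cong (λ i i<n → sym (entry-mapVec zag i i<n))
      (LinkedIn-mirrored sa<n (zigzag-links (trans (mirror-parity n-even sa<n) (T⇒≡true even)) (mirror-candidate sa<n))))

  τ⁺-unique : ∀ {σ} → σ ∈ I⁺.E → I⁺.Fixed σ → σ ≡ τ⁺
  τ⁺-unique {σ} m fixed = entry-ext σ τ⁺ λ i i<n → begin
    entry σ i                           ≡⟨ mirror-involutive (entry-bound σ i i<n) ⟨
    mirror n (mirror n (entry σ i))     ≡⟨ cong (mirror n) (is-zigzag i i<n) ⟩
    mirror n (zigzag i)                 ≡⟨ entry-mapVec zag i i<n ⟨
    entry τ⁺ i                          ∎
    where
    open ≡-Reasoning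
    reflected-link : ∀ k → suc (k + k) < n → LinkedIn (mirror n ∘ entry σ) n (k + k)
    reflected-link k bound = LinkedIn-mirrored bound (linked⇒LinkedIn _ σ (I⁺.fixed⇒linked fixed
      (∈candidates⁺ {true} {n} (≡true⇒T (trans (mirror-parity n-even bound) (isEven-double k))) (mirror-candidate bound))))
    open DownUpZigzag (mirrorMap (entryMap false σ (proj₁ (I⁺.∈E⁻ m)) (proj₂ (I⁺.∈E⁻ m)))) n-even reflected-link

-- For odd n ≥ 2 there are no fixed points: on E⁺ the value 0 (even) cannot be linked, and on E⁻
-- the value n-2 (odd) cannot be linked, as reflecting the values turns this into the E⁺ case.
upDown-odd-no-fixed : ∀ n → isEven n ≡ false → 2 ≤ n →
  ∀ {σ} → σ ∈ Involution.E false true n → ¬ Involution.Fixed false true n σ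
upDown-odd-no-fixed n n-odd 2≤n {σ} m fixed =
  upDown-odd-unlinked (entryMap false σ (proj₁ (∈E⁻ m)) (proj₂ (∈E⁻ m))) n-odd
    (linked⇒LinkedIn 0 σ (fixed⇒linked fixed (∈candidates⁺ {true} {n} {0} tt 2≤n)))
  where open Involution false true n

downUp-odd-no-fixed : ∀ n → isEven n ≡ false → 2 ≤ n →
  ∀ {σ} → σ ∈ Involution.E true false n → ¬ Involution.Fixed true false n σ
downUp-odd-no-fixed (suc zero)    _     (s≤s ()) _ _
downUp-odd-no-fixed (suc (suc a)) n-odd _ {σ} m fixed =
  upDown-odd-unlinked (mirrorMap (entryMap true σ (proj₁ (∈E⁻ m)) (proj₂ (∈E⁻ m)))) n-odd
    (subst (LinkedIn _ (suc (suc a))) (ℕₚ.n∸n≡0 a) (LinkedIn-mirror (ℕₚ.n<1+n (suc a)) top-link))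
  where
  open Involution true false (suc (suc a))
  top-link : LinkedIn (entry σ) (suc (suc a)) a
  top-link = linked⇒LinkedIn a σ (fixed⇒linked fixed (∈candidates⁺ {false} {suc (suc a)} {a}
    (Equivalence.from Boolₚ.T-not-≡ (trans (sym (Boolₚ.not-involutive _)) n-odd)) (ℕₚ.n<1+n (suc a))))

count : (ℕ → Bool) → ℕ → ℕ
count g m = length (filterᵇ g (upTo m))

indicator : Bool → ℕ
indicator b = if b then 1 else 0

length-filterᵇ-++ : ∀ {A : Set} (g : A → Bool) xs ys → length (filterᵇ g (xs ++ ys)) ≡ length (filterᵇ g xs) + length (filterᵇ g ys)
length-filterᵇ-++ g xs ys = trans (cong length (Listₚ.filter-++ (T? ∘ g) xs ys)) (Listₚ.length-++ (filterᵇ g xs))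

length-filterᵇ-map : ∀ {A B : Set} (g : B → Bool) (h : A → B) xs → length (filterᵇ g (map h xs)) ≡ length (filterᵇ (g ∘ h) xs)
length-filterᵇ-map g h []       = refl
length-filterᵇ-map g h (x ∷ xs) with g (h x)
... | true  = cong suc (length-filterᵇ-map g h xs)
... | false = length-filterᵇ-map g h xs

count-suc : ∀ g m → count g (suc m) ≡ count g m + indicator (g m)
count-suc g m = trans (cong (length ∘ filterᵇ g) (sym (Listₚ.applyUpTo-∷ʳ (λ i → i) m)))
                      (trans (length-filterᵇ-++ g (upTo m) [ m ]) (cong (count g m +_) last))
  where
  last : length (filterᵇ g [ m ]) ≡ indicator (g m)
  last with g m
  ... | true  = refl
  ... | false = refl

count-cong : ∀ {g h} m → (∀ i → i < m → g i ≡ h i) → count g m ≡ count h m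
count-cong m same = cong length (filterᵇ-cong (upTo m) (λ {i} i∈ → same i (∈-upTo⁻ i∈)))

count-none : ∀ g m → (∀ i → i < m → g i ≡ false) → count g m ≡ 0
count-none g m none = trans (count-cong m none) (cong length (Listₚ.filter-none (T? ∘ (λ _ → false)) {xs = upTo m} (All.tabulate (λ _ ()))))

count-all : ∀ g m → (∀ i → i < m → g i ≡ true) → count g m ≡ m
count-all g m all = trans (count-cong m all) (trans (cong length (Listₚ.filter-all (T? ∘ (λ _ → true)) {xs = upTo m} (All.tabulate (λ _ → tt))))
                                                    (Listₚ.length-upTo m))

count-parity : ∀ p k → count (hasParity p) (k + k) ≡ k
count-parity p zero    = refl
count-parity p (suc k) = begin
  count (hasParity p) (suc k + suc k)                                            ≡⟨ cong (count (hasParity p)) (cong suc (ℕₚ.+-suc k k)) ⟩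
  count (hasParity p) (suc (suc (k + k)))                                        ≡⟨ count-suc (hasParity p) (suc (k + k)) ⟩
  count (hasParity p) (suc (k + k)) + indicator (hasParity p (suc (k + k)))
    ≡⟨ cong (_+ indicator (hasParity p (suc (k + k)))) (count-suc (hasParity p) (k + k)) ⟩
  count (hasParity p) (k + k) + indicator (hasParity p (k + k)) + indicator (hasParity p (suc (k + k)))
    ≡⟨ cong (λ u → u + indicator (hasParity p (k + k)) + indicator (hasParity p (suc (k + k)))) (count-parity p k) ⟩
  k + indicator (hasParity p (k + k)) + indicator (hasParity p (suc (k + k)))    ≡⟨ ℕₚ.+-assoc k _ _ ⟩
  k + (indicator (hasParity p (k + k)) + indicator (hasParity p (suc (k + k))))  ≡⟨ cong (k +_) (one-of-two p {k + k} (isEven-double k)) ⟩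
  k + 1                                                                          ≡⟨ ℕₚ.+-comm k 1 ⟩
  suc k                                                                          ∎
  where
  open ≡-Reasoning
  one-of-two : ∀ p {v} → isEven v ≡ true → indicator (hasParity p v) + indicator (hasParity p (suc v)) ≡ 1
  one-of-two true  e rewrite e = refl
  one-of-two false e rewrite e = refl

-- The pairs i < j < n of natural numbers, listed by their larger component: a reordering of
-- `pairs n` suited to counting row by row.
natPairs : ℕ → List (ℕ × ℕ)
natPairs zero    = []
natPairs (suc n) = natPairs n ++ map (λ i → (i , n)) (upTo n)

∈natPairs⁻ : ∀ {n i j} → (i , j) ∈ natPairs n → i < j × j < n
∈natPairs⁻ {suc n} m with ∈-++⁻ (natPairs n) m
... | inj₁ m′ = let i<j , j<n = ∈natPairs⁻ {n} m′ in i<j , ℕₚ.<-trans j<n (ℕₚ.n<1+n n)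
... | inj₂ m′ with ∈-map⁻ _ m′
...   | _ , i∈ , refl = ∈-upTo⁻ i∈ , ℕₚ.n<1+n n

∈natPairs⁺ : ∀ {n i j} → i < j → j < n → (i , j) ∈ natPairs n
∈natPairs⁺ {suc n} i<j j<sn with ℕₚ.m≤n⇒m<n∨m≡n (ℕₚ.≤-pred j<sn)
... | inj₁ j<n  = ∈-++⁺ˡ (∈natPairs⁺ i<j j<n)
... | inj₂ refl = ∈-++⁺ʳ (natPairs n) (∈-map⁺ _ (∈-upTo⁺ i<j))

natPairs-unique : ∀ n → Unique (natPairs n)
natPairs-unique zero    = []
natPairs-unique (suc n) = Uniqueₚ.++⁺ (natPairs-unique n) (Uniqueₚ.map⁺ (cong proj₁) (Uniqueₚ.upTo⁺ n)) disjoint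
  where
  disjoint : ∀ {v} → ¬ (v ∈ natPairs n × v ∈ map (λ i → (i , n)) (upTo n))
  disjoint (m₁ , m₂) with ∈-map⁻ _ m₂
  ... | _ , _ , refl = ℕₚ.<-irrefl refl (proj₂ (∈natPairs⁻ m₁))

toℕ² : ∀ {n} → Fin n × Fin n → ℕ × ℕ
toℕ² (i , j) = toℕ i , toℕ j

pairs↭natPairs : ∀ n → map toℕ² (pairs n) ↭ natPairs n
pairs↭natPairs n = ∼bag⇒↭ (unique∧set⇒bag (Uniqueₚ.map⁺ toℕ²-injective (pairs-unique n)) (natPairs-unique n) (mk⇔ to from))
  where
  toℕ²-injective : ∀ {p q : Fin n × Fin n} → toℕ² p ≡ toℕ² q → p ≡ q
  toℕ²-injective e = cong₂ _,_ (Finₚ.toℕ-injective (cong proj₁ e)) (Finₚ.toℕ-injective (cong proj₂ e))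
  to : ∀ {v} → v ∈ map toℕ² (pairs n) → v ∈ natPairs n
  to m with ∈-map⁻ _ m
  ... | (i , j) , m′ , refl = ∈natPairs⁺ (∈pairs⁻ m′) (Finₚ.toℕ<n j)
  from : ∀ {v} → v ∈ natPairs n → v ∈ map toℕ² (pairs n)
  from {i , j} m with ∈natPairs⁻ m
  ... | i<j , j<n = subst (_∈ map toℕ² (pairs n)) (cong₂ _,_ (Finₚ.toℕ-fromℕ< i<n) (Finₚ.toℕ-fromℕ< j<n))
      (∈-map⁺ toℕ² (∈pairs⁺ (subst₂ _<_ (sym (Finₚ.toℕ-fromℕ< i<n)) (sym (Finₚ.toℕ-fromℕ< j<n)) i<j)))
    where i<n = ℕₚ.<-trans i<j j<n

countPairs : (ℕ → ℕ → Bool) → ℕ → ℕ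
countPairs r n = length (filterᵇ (λ { (i , j) → r i j }) (natPairs n))

row : (ℕ → ℕ → Bool) → ℕ → ℕ
row r j = count (λ i → r i j) j

countPairs-suc : ∀ r n → countPairs r (suc n) ≡ countPairs r n + row r n
countPairs-suc r n = trans (length-filterᵇ-++ _ (natPairs n) _) (cong (countPairs r n +_) (length-filterᵇ-map _ (λ i → (i , n)) (upTo n)))

countPairs-double : ∀ r k → countPairs r (suc k + suc k) ≡ countPairs r (k + k) + row r (k + k) + row r (suc (k + k))
countPairs-double r k = trans (cong (countPairs r) (cong suc (ℕₚ.+-suc k k)))
  (trans (countPairs-suc r (suc (k + k))) (cong (_+ row r (suc (k + k))) (countPairs-suc r (k + k))))

count-pairs : ∀ {n} (Q : Fin n × Fin n → Bool) (r : ℕ → ℕ → Bool) →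
  (∀ {i j} → (i , j) ∈ pairs n → Q (i , j) ≡ r (toℕ i) (toℕ j)) → length (filterᵇ Q (pairs n)) ≡ countPairs r n
count-pairs {n} Q r agree = trans (cong length (filterᵇ-cong (pairs n) (λ { {i , j} m → agree m })))
  (trans (sym (length-filterᵇ-map _ toℕ² (pairs n))) (↭-length (filter-↭ _ (pairs↭natPairs n))))

isBlock : ℕ → ℕ → Bool
isBlock i j = isEven i ∧ (j ≡ᵇ suc i)

oppositeParity : ℕ → ℕ → Bool
oppositeParity i j = not (isEven (i + j))

isEven-+-hasParity : ∀ i j → isEven (i + j) ≡ hasParity (isEven j) i
isEven-+-hasParity i j rewrite isEven-+ i j with isEven i | isEven j
... | true  | true  = refl
... | true  | false = refl
... | false | true  = refl
... | false | false = refl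

isEven-+-even : ∀ a b → isEven b ≡ true → isEven (a + b) ≡ isEven a
isEven-+-even a b e rewrite isEven-+ a b | e with isEven a
... | true  = refl
... | false = refl

-- Rows of the three relations. Row j+1 only sees i ≤ j, and i < j is never a block with j+1.
not-block-below : ∀ {i j} → i < j → isBlock i (suc j) ≡ false
not-block-below {i} {j} i<j = trans (cong (isEven i ∧_) (≢⇒≡ᵇ-false (ℕₚ.<⇒≢ i<j ∘ sym))) (Boolₚ.∧-zeroʳ (isEven i))

row-block : ∀ j → row isBlock (suc j) ≡ indicator (isEven j)
row-block j = begin
  row isBlock (suc j)                                        ≡⟨ count-suc (λ i → isBlock i (suc j)) j ⟩
  count (λ i → isBlock i (suc j)) j + indicator (isBlock j (suc j))
    ≡⟨ cong₂ _+_ (count-none _ j (λ i → not-block-below)) (cong (indicator ∘ (isEven j ∧_)) (≡ᵇ-refl j)) ⟩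
  indicator (isEven j ∧ true)                                ≡⟨ cong indicator (Boolₚ.∧-identityʳ (isEven j)) ⟩
  indicator (isEven j)                                       ∎
  where open ≡-Reasoning

nonBlock : ℕ → ℕ → Bool
nonBlock i j = not (isBlock i j)

nonBlockOpposite : ℕ → ℕ → Bool
nonBlockOpposite i j = nonBlock i j ∧ oppositeParity i j

row-nonBlock : ∀ j → row nonBlock (suc j) ≡ j + indicator (not (isEven j))
row-nonBlock j = begin
  row nonBlock (suc j)                                               ≡⟨ count-suc (λ i → nonBlock i (suc j)) j ⟩
  count (λ i → nonBlock i (suc j)) j + indicator (nonBlock j (suc j))
    ≡⟨ cong₂ _+_ (count-all _ j (λ i i<j → cong not (not-block-below i<j))) (cong (λ b → indicator (not (isEven j ∧ b))) (≡ᵇ-refl j)) ⟩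
  j + indicator (not (isEven j ∧ true))                              ≡⟨ cong (λ b → j + indicator (not b)) (Boolₚ.∧-identityʳ (isEven j)) ⟩
  j + indicator (not (isEven j))                                     ∎
  where open ≡-Reasoning

row-nonBlockOpposite : ∀ j → row nonBlockOpposite (suc j) ≡ count (hasParity (isEven j)) j + indicator (not (isEven j))
row-nonBlockOpposite j = begin
  row nonBlockOpposite (suc j)
    ≡⟨ count-suc (λ i → nonBlockOpposite i (suc j)) j ⟩
  count (λ i → nonBlockOpposite i (suc j)) j + indicator (nonBlockOpposite j (suc j))
    ≡⟨ cong₂ _+_ (count-cong j earlier) (cong indicator last) ⟩
  count (hasParity (isEven j)) j + indicator (not (isEven j))
    ∎
  where
  open ≡-Reasoning
  earlier : ∀ i → i < j → nonBlockOpposite i (suc j) ≡ hasParity (isEven j) i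
  earlier i i<j rewrite not-block-below i<j | isEven-+suc i j =
    trans (Boolₚ.not-involutive (isEven (i + j))) (isEven-+-hasParity i j)
  last : nonBlockOpposite j (suc j) ≡ not (isEven j)
  last rewrite ≡ᵇ-refl j | isEven-consecutive j = trans (Boolₚ.∧-identityʳ _) (cong not (Boolₚ.∧-identityʳ (isEven j)))

row-double-suc : ∀ r k → row r (suc k + suc k) ≡ row r (suc (suc (k + k)))
row-double-suc r k = cong (row r) (cong suc (ℕₚ.+-suc k k))

count-blocks : ∀ k → countPairs isBlock (k + k) ≡ k
count-blocks zero    = refl
count-blocks (suc k) = begin
  countPairs isBlock (suc k + suc k)                                         ≡⟨ countPairs-double isBlock k ⟩
  countPairs isBlock (k + k) + row isBlock (k + k) + row isBlock (suc (k + k)) ≡⟨ cong₂ _+_ (cong₂ _+_ (count-blocks k) (row-even k))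
                                                                                        (trans (row-block (k + k)) (cong indicator (isEven-double k))) ⟩
  k + 0 + 1                                                                  ≡⟨ trans (cong (_+ 1) (ℕₚ.+-identityʳ k)) (ℕₚ.+-comm k 1) ⟩
  suc k                                                                      ∎
  where
  open ≡-Reasoning
  row-even : ∀ k → row isBlock (k + k) ≡ 0
  row-even zero    = refl
  row-even (suc k) = trans (row-double-suc isBlock k) (trans (row-block (suc (k + k))) (cong (indicator ∘ not) (isEven-double k)))

count-blocks-opposite : ∀ n → countPairs (λ i j → isBlock i j ∧ oppositeParity i j) n ≡ countPairs isBlock n
count-blocks-opposite n = cong length (filterᵇ-cong (natPairs n) λ { {i , j} m → block-opposite i j })
  where
  block-opposite : ∀ i j → (isBlock i j ∧ oppositeParity i j) ≡ isBlock i j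
  block-opposite i j with isBlock i j in e
  ... | false = refl
  ... | true = trans (cong (λ z → not (isEven (i + z))) adj) (cong not (isEven-consecutive i))
    where adj = ℕₚ.≡ᵇ⇒≡ j (suc i) (proj₂ (Equivalence.to (Boolₚ.T-∧ {isEven i}) (≡true⇒T e)))

-- The non-blocks below 2k are even in number: rows 2t and 2t+1 both have 2t of them.
count-nonBlocks-even : ∀ k → isEven (countPairs nonBlock (k + k)) ≡ true
count-nonBlocks-even zero    = refl
count-nonBlocks-even (suc k) = begin
  isEven (countPairs nonBlock (suc k + suc k))                                       ≡⟨ cong isEven (countPairs-double nonBlock k) ⟩
  isEven (countPairs nonBlock (k + k) + row nonBlock (k + k) + row nonBlock (suc (k + k)))
    ≡⟨ isEven-+-even (countPairs nonBlock (k + k) + row nonBlock (k + k)) _ (trans (cong isEven (row-odd k)) (isEven-double k)) ⟩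
  isEven (countPairs nonBlock (k + k) + row nonBlock (k + k))
    ≡⟨ isEven-+-even (countPairs nonBlock (k + k)) _ (trans (cong isEven (row-even k)) (isEven-double k)) ⟩
  isEven (countPairs nonBlock (k + k))                                               ≡⟨ count-nonBlocks-even k ⟩
  true                                                                               ∎
  where
  open ≡-Reasoning
  row-even : ∀ k → row nonBlock (k + k) ≡ k + k
  row-even zero    = refl
  row-even (suc k) = trans (row-double-suc nonBlock k) (trans (row-nonBlock (suc (k + k)))
    (trans (cong (λ b → suc (k + k) + indicator (not (not b))) (isEven-double k))
    (trans (ℕₚ.+-comm (suc (k + k)) 1) (cong suc (sym (ℕₚ.+-suc k k))))))
  row-odd : ∀ k → row nonBlock (suc (k + k)) ≡ k + k
  row-odd k = trans (row-nonBlock (k + k)) (trans (cong (λ b → k + k + indicator (not b)) (isEven-double k)) (ℕₚ.+-identityʳ (k + k)))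

-- The non-block pairs of opposite parity below 2k: rows 2t and 2t+1 both have t of them.
count-nonBlocks-opposite : ∀ k → countPairs nonBlockOpposite (k + k) ≡ k * (k ∸ 1)
count-nonBlocks-opposite zero    = refl
count-nonBlocks-opposite (suc k) = begin
  countPairs nonBlockOpposite (suc k + suc k)                                                       ≡⟨ countPairs-double nonBlockOpposite k ⟩
  countPairs nonBlockOpposite (k + k) + row nonBlockOpposite (k + k) + row nonBlockOpposite (suc (k + k))
    ≡⟨ cong₂ _+_ (cong₂ _+_ (count-nonBlocks-opposite k) (row-even k)) (row-odd k) ⟩
  k * (k ∸ 1) + k + k                                                                                ≡⟨ cong (_+ k) (square k) ⟩
  k * k + k                                                                                          ≡⟨ ℕₚ.+-comm (k * k) k ⟩
  suc k * (suc k ∸ 1)                                                                                ∎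
  where
  open ≡-Reasoning
  square : ∀ k → k * (k ∸ 1) + k ≡ k * k
  square zero    = refl
  square (suc k) = trans (ℕₚ.+-comm (suc k * k) (suc k)) (sym (ℕₚ.*-suc (suc k) k))
  row-even : ∀ k → row nonBlockOpposite (k + k) ≡ k
  row-even zero    = refl
  row-even (suc k) = begin
    row nonBlockOpposite (suc k + suc k)                                               ≡⟨ row-double-suc nonBlockOpposite k ⟩
    row nonBlockOpposite (suc (suc (k + k)))                                           ≡⟨ row-nonBlockOpposite (suc (k + k)) ⟩
    count (hasParity (not (isEven (k + k)))) (suc (k + k)) + indicator (not (not (isEven (k + k))))
      ≡⟨ cong (λ b → count (hasParity (not b)) (suc (k + k)) + indicator (not (not b))) (isEven-double k) ⟩
    count (hasParity false) (suc (k + k)) + 1                                          ≡⟨ cong (_+ 1) (count-suc (hasParity false) (k + k)) ⟩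
    count (hasParity false) (k + k) + indicator (not (isEven (k + k))) + 1
      ≡⟨ cong₂ (λ c b → c + indicator (not b) + 1) (count-parity false k) (isEven-double k) ⟩
    k + 0 + 1                                                                          ≡⟨ trans (cong (_+ 1) (ℕₚ.+-identityʳ k)) (ℕₚ.+-comm k 1) ⟩
    suc k                                                                              ∎
  row-odd : ∀ k → row nonBlockOpposite (suc (k + k)) ≡ k
  row-odd k = begin
    row nonBlockOpposite (suc (k + k))                                                 ≡⟨ row-nonBlockOpposite (k + k) ⟩
    count (hasParity (isEven (k + k))) (k + k) + indicator (not (isEven (k + k)))
      ≡⟨ cong (λ b → count (hasParity b) (k + k) + indicator (not b)) (isEven-double k) ⟩
    count (hasParity true) (k + k) + 0                                                 ≡⟨ cong (_+ 0) (count-parity true k) ⟩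
    k + 0                                                                              ≡⟨ ℕₚ.+-identityʳ k ⟩
    k                                                                                  ∎

zigzag-≥pred : ∀ j → pred j ≤ zigzag j
zigzag-≥pred j with isEven j
... | true  = ℕₚ.≤-trans ℕₚ.pred[n]≤n (ℕₚ.n≤1+n j)
... | false = ℕₚ.≤-refl

zigzag-inversion : ∀ {i j} → i < j → (zigzag j <ᵇ zigzag i) ≡ isBlock i j
zigzag-inversion {i} {j} i<j with isEven i in ei
... | true  = T-ext
  (λ t → ℕₚ.≡⇒≡ᵇ j (suc i) (ℕₚ.≤-antisym (pred≤⇒≤suc (ℕₚ.≤-trans (zigzag-≥pred j) (ℕₚ.≤-pred (ℕₚ.<ᵇ⇒< _ _ t)))) i<j))
                    (λ t → ℕₚ.<⇒<ᵇ (subst (λ z → zigzag z < suc i) (sym (ℕₚ.≡ᵇ⇒≡ j (suc i) t))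
                                       (subst (_< suc i) (sym (zigzag-odd (suc i) (cong not ei))) (ℕₚ.n<1+n i))))
  where
  pred≤⇒≤suc : ∀ {j i} → pred j ≤ i → j ≤ suc i
  pred≤⇒≤suc {zero}  _ = z≤n
  pred≤⇒≤suc {suc j} p = s≤s p
... | false = ≮⇒<ᵇ-false (λ lt → ℕₚ.<⇒≱ lt (ℕₚ.≤-trans ℕₚ.pred[n]≤n (ℕₚ.≤-trans (<⇒≤pred i<j) (zigzag-≥pred j))))
  where
  <⇒≤pred : ∀ {i j} → i < j → i ≤ pred j
  <⇒≤pred (s≤s p) = p

mirror-<ᵇ : ∀ {n x y} → x < n → y < n → (mirror n y <ᵇ mirror n x) ≡ (x <ᵇ y)
mirror-<ᵇ {n} {x} {y} x<n y<n = <ᵇ-cong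
  (λ lt → ℕₚ.≰⇒> (λ y≤x → ℕₚ.<⇒≱ lt (ℕₚ.∸-monoʳ-≤ n (s≤s y≤x))))
  (λ x<y → mirror-reverses x<y y<n)

-- The statistics of the two fixed points for n = 2k: ℓ(τ⁻) = L(τ⁻) = k (the inversions are the
-- k blocks), while the inversions of τ⁺ are the non-blocks, even in number, of which k(k-1)
-- join positions of opposite parity.
module FixedPointStatistics (k : ℕ) where
  open EvenFixedPoints (k + k) (isEven-double k)

  value-τ⁻ : ∀ i → value τ⁻ i ≡ zigzag (toℕ i)
  value-τ⁻ i = trans (sym (entry-value τ⁻ i)) (entry-mapVec zig (toℕ i) (Finₚ.toℕ<n i))

  value-τ⁺ : ∀ i → value τ⁺ i ≡ mirror (k + k) (zigzag (toℕ i))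
  value-τ⁺ i = trans (sym (entry-value τ⁺ i)) (entry-mapVec zag (toℕ i) (Finₚ.toℕ<n i))

  inversion-τ⁻ : ∀ {i j} → (i , j) ∈ pairs (k + k) → isInv τ⁻ (i , j) ≡ isBlock (toℕ i) (toℕ j)
  inversion-τ⁻ {i} {j} m = trans (cong₂ _<ᵇ_ (value-τ⁻ j) (value-τ⁻ i)) (zigzag-inversion (∈pairs⁻ m))

  inversion-τ⁺ : ∀ {i j} → (i , j) ∈ pairs (k + k) → isInv τ⁺ (i , j) ≡ nonBlock (toℕ i) (toℕ j)
  inversion-τ⁺ {i} {j} m = begin
    isInv τ⁺ (i , j)                                                    ≡⟨ cong₂ _<ᵇ_ (value-τ⁺ j) (value-τ⁺ i) ⟩
    mirror (k + k) (zigzag (toℕ j)) <ᵇ mirror (k + k) (zigzag (toℕ i))  ≡⟨ mirror-<ᵇ (AltMap.bounded zig _ (Finₚ.toℕ<n i))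
                                                                                        (AltMap.bounded zig _ (Finₚ.toℕ<n j)) ⟩
    zigzag (toℕ i) <ᵇ zigzag (toℕ j)                                    ≡⟨ <ᵇ-flip (ℕₚ.<⇒≢ (∈pairs⁻ m) ∘ zigzag-injective) ⟩
    not (zigzag (toℕ j) <ᵇ zigzag (toℕ i))                              ≡⟨ cong not (zigzag-inversion (∈pairs⁻ m)) ⟩
    nonBlock (toℕ i) (toℕ j)                                            ∎
    where open ≡-Reasoning

  oppParity-toℕ : ∀ (i j : Fin (k + k)) → oppParity (i , j) ≡ oppositeParity (toℕ i) (toℕ j)
  oppParity-toℕ i j = odd-test (toℕ i + toℕ j)

  ℓ-τ⁻ : ℓ τ⁻ ≡ k
  ℓ-τ⁻ = trans (count-pairs (isInv τ⁻) isBlock inversion-τ⁻) (count-blocks k)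

  L-τ⁻ : L τ⁻ ≡ k
  L-τ⁻ = trans (count-pairs _ (λ i j → isBlock i j ∧ oppositeParity i j) (λ {i} {j} m → cong₂ _∧_ (inversion-τ⁻ m) (oppParity-toℕ i j)))
               (trans (count-blocks-opposite (k + k)) (count-blocks k))

  ℓ-τ⁺-even : isEven (ℓ τ⁺) ≡ true
  ℓ-τ⁺-even = trans (cong isEven (count-pairs (isInv τ⁺) nonBlock inversion-τ⁺)) (count-nonBlocks-even k)

  L-τ⁺ : L τ⁺ ≡ k * (k ∸ 1)
  L-τ⁺ = trans (count-pairs _ nonBlockOpposite (λ {i} {j} m → cong₂ _∧_ (inversion-τ⁺ m) (oppParity-toℕ i j)))
               (count-nonBlocks-opposite k)

-- The four evaluations of Σ_{σ ∈ E} (-1)^ℓ(σ) x^L(σ). Note that Eminus n and Eplus n are, by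
-- definition, the lists E of Involution true _ n and Involution false _ n, and signedSum is sumᴿ weight.
module Evaluations {c ℓ′ : Level} (R : CommutativeRing c ℓ′) (x : CommutativeRing.Carrier R) where
  open CommutativeRing R using (_≈_; 0#; 1#; -_; *-identityˡ) renaming (_*_ to _*ᴿ_; setoid to ≈-setoid)
  open import Relation.Binary.Reasoning.Setoid ≈-setoid
  open RingSums R using (sign-power; even-sign)

  downUp-even : ∀ k → signedSum R (Eminus (k + k)) x ≈ pow R (- x) k
  downUp-even k = begin
    signedSum R (Eminus (k + k)) x                  ≈⟨ sum-single-fixed τ⁻-unique τ⁻∈E τ⁻-fixed ⟩
    pow R (- 1#) (ℓ τ⁻) *ᴿ pow R x (L τ⁻)           ≡⟨ cong₂ (λ a b → pow R (- 1#) a *ᴿ pow R x b) ℓ-τ⁻ L-τ⁻ ⟩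
    pow R (- 1#) k *ᴿ pow R x k                     ≈⟨ sign-power x k ⟩
    pow R (- x) k                                   ∎
    where
    open EvenFixedPoints (k + k) (isEven-double k)
    open FixedPointStatistics k
    open Reduction R x true true (k + k)

  upDown-even : ∀ k → signedSum R (Eplus (k + k)) x ≈ pow R x (k * (k ∸ 1))
  upDown-even k = begin
    signedSum R (Eplus (k + k)) x                   ≈⟨ sum-single-fixed τ⁺-unique τ⁺∈E τ⁺-fixed ⟩
    pow R (- 1#) (ℓ τ⁺) *ᴿ pow R x (L τ⁺)           ≈⟨ even-sign (ℓ τ⁺) (pow R x (L τ⁺)) ℓ-τ⁺-even ⟩
    pow R x (L τ⁺)                                  ≡⟨ cong (pow R x) L-τ⁺ ⟩
    pow R x (k * (k ∸ 1))                           ∎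
    where
    open EvenFixedPoints (k + k) (isEven-double k)
    open FixedPointStatistics k
    open Reduction R x false true (k + k)

  downUp-odd : ∀ n → isEven n ≡ false → 2 ≤ n → signedSum R (Eminus n) x ≈ 0#
  downUp-odd n odd 2≤n = Reduction.sum-no-fixed R x true false n (downUp-odd-no-fixed n odd 2≤n)

  upDown-odd : ∀ n → isEven n ≡ false → 2 ≤ n → signedSum R (Eplus n) x ≈ 0#
  upDown-odd n odd 2≤n = Reduction.sum-no-fixed R x false true n (upDown-odd-no-fixed n odd 2≤n)

proposition3p4 : {c ℓ′ : Level} (R : CommutativeRing c ℓ′) (x : CommutativeRing.Carrier R) →
    ((m : ℕ) → 1 ≤ m →
      (CommutativeRing._≈_ R (signedSum R (Eminus (2 * m + 1)) x) (CommutativeRing.0# R)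
        × CommutativeRing._≈_ R (signedSum R (Eplus (2 * m + 1)) x) (CommutativeRing.0# R)))
    × ((m : ℕ) → 1 ≤ m →
      (CommutativeRing._≈_ R (signedSum R (Eminus (2 * m)) x) (pow R (CommutativeRing.-_ R x) m)
        × CommutativeRing._≈_ R (signedSum R (Eplus (2 * m)) x) (pow R x (m * (m ∸ 1)))))
proposition3p4 R x = odd-lengths , even-lengths
  where
  open Evaluations R x
  double : ∀ m → m + m ≡ 2 * m
  double m = cong (m +_) (sym (ℕₚ.+-identityʳ m))
  odd : ∀ m → isEven (2 * m + 1) ≡ false
  odd m = trans (cong isEven (ℕₚ.+-comm (2 * m) 1)) (trans (cong (not ∘ isEven) (sym (double m))) (cong not (isEven-double m)))
  at-least-two : ∀ m → 1 ≤ m → 2 ≤ 2 * m + 1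
  at-least-two m 1≤m = ℕₚ.≤-trans (ℕₚ.*-monoʳ-≤ 2 1≤m) (ℕₚ.m≤m+n (2 * m) 1)
  odd-lengths = λ m 1≤m → downUp-odd (2 * m + 1) (odd m) (at-least-two m 1≤m) , upDown-odd (2 * m + 1) (odd m) (at-least-two m 1≤m)
  even-lengths = λ m _ → subst (λ n → CommutativeRing._≈_ R (signedSum R (Eminus n) x) (pow R (CommutativeRing.-_ R x) m)) (double m) (downUp-even m) ,
                         subst (λ n → CommutativeRing._≈_ R (signedSum R (Eplus n) x) (pow R x (m * (m ∸ 1)))) (double m) (upDown-even m)
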